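{- Let $m\ge2$ and let $\lambda=(\lambda_1,\ldots,\lambda_m)$ be a partition of $n$ with at most $m$ parts. Let $\lambda'=(\lambda_1-\lambda_m,\ldots,\lambda_{m-1}-\lambda_m,0)$. Then $\mathrm{Newt}(s_\lambda(x_1,\ldots,x_m))$ is reflexive if and only if $\lambda'$ is one of: $(m,0,\ldots,0)$ (a partition of $m$); $(2,1,\ldots,1,0)$ (a partition of $m$); $(2,\ldots,2,0,\ldots,0)$ with $m/2$ twos and $m/2$ zeros, when $m$ is even; $(2,\ldots,2,1,0,\ldots,0)$ with $(m-1)/2$ twos, one $1$ and $(m-1)/2$ zeros, when $m$ is odd; $(m,\ldots,m,0)$ with $m-1$ entries equal to $m$ (a partition of $m(m-1)$).
   Context: $\mathrm{Newt}(s_\lambda(x_1,\ldots,x_m))$ is the convex hull of the exponent vectors of the Schur polynomial $s_\lambda(x_1,\ldots,x_m)=\sum_T\mathbf{x}^T$ over semistandard Young tableaux of shape $\lambda$ with entries in $\{1,\ldots,m\}$; it equals the convex hull of the $S_m$-orbit of $(\lambda_1,\ldots,\lambda_m)$. The partition $\lambda'$ is said to be obtained from $\lambda$ by reduction by translation. A lattice polytope $\mathcal{P}\subset\mathbb{R}^m$ (possibly not full-dimensional) is reflexive if there is a lattice point $\mathbf{p}$ in its relative interior at lattice distance $1$ from every facet: for each facet $F$ there are no lattice points of $\mathrm{aff}(\mathcal{P})$ strictly between the affine span of $F$ within $\mathrm{aff}(\mathcal{P})$ and its parallel translate through $\mathbf{p}$ (equivalently, after a lattice-preserving identification of $\mathrm{aff}(\mathcal{P})$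 with $\mathbb{R}^k$ and translation by $-\mathbf{p}$, the polar dual is a lattice polytope). -}

module Defs where

open import Data.Nat as ℕ using (ℕ; zero; suc; _∸_; _<ᵇ_; _≡ᵇ_; _%_; _/_)
open import Data.Integer as ℤ using (ℤ; +_)
open import Data.Rational as ℚ using (ℚ; 0ℚ; 1ℚ)
open import Data.Fin as Fin using (Fin; toℕ)
open import Data.Fin.Permutation using (Permutation′; _⟨$⟩ʳ_)
open import Data.List using (List; []; _∷_)
open import Data.Product using (Σ; ∃; _×_; _,_)
open import Data.Sum using (_⊎_)
open import Data.Bool using (if_then_else_)
open import Data.Unit using (⊤)
open import Relation.Binary.PropositionalEquality using (_≡_)
open import Relation.Nullary using (¬_)

Point : ℕ → Set
Point m = Fin m → ℤ

sumFinℤ : (m : ℕ) → (Fin m → ℤ) → ℤ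
sumFinℤ zero    f = + 0
sumFinℤ (suc m) f = f Fin.zero ℤ.+ sumFinℤ m (λ i → f (Fin.suc i))

dot : {m : ℕ} → Point m → Point m → ℤ
dot {m} a x = sumFinℤ m (λ i → a i ℤ.* x i)

toℚ : ℤ → ℚ
toℚ z = z ℚ./ 1

PointSet : ℕ → Set₁
PointSet m = Point m → Set

Family : {m : ℕ} → PointSet m → Set
Family {m} S = List (ℚ × Σ (Point m) S)

weightSum : {m : ℕ} {S : PointSet m} → Family S → ℚ
weightSum []                  = 0ℚ
weightSum ((q , _) ∷ fs) = q ℚ.+ weightSum fs

combo : {m : ℕ} {S : PointSet m} → Family S → Fin m → ℚ
combo []                   i = 0ℚ
combo ((q , v , _) ∷ fs) i = q ℚ.* toℚ (v i) ℚ.+ combo fs i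

AllNonneg : {m : ℕ} {S : PointSet m} → Family S → Set
AllNonneg []               = ⊤
AllNonneg ((q , _) ∷ fs) = (0ℚ ℚ.≤ q) × AllNonneg fs

InAff : {m : ℕ} → PointSet m → Point m → Set
InAff {m} S x = ∃ λ (fs : Family S) →
  (weightSum fs ≡ 1ℚ) × (∀ i → combo fs i ≡ toℚ (x i))

InConv : {m : ℕ} → PointSet m → Point m → Set
InConv {m} S x = ∃ λ (fs : Family S) →
  AllNonneg fs × (weightSum fs ≡ 1ℚ) × (∀ i → combo fs i ≡ toℚ (x i))

MaxAt : {m : ℕ} → PointSet m → Point m → Point m → Set
MaxAt S a v = S v × (∀ w → S w → dot a w ℤ.≤ dot a v)

-- the vertices of S lying on the face of conv(S) exposed by a
OnFace : {m : ℕ} → PointSet m → Point m → Point m → Set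
OnFace = MaxAt

ProperFace : {m : ℕ} → PointSet m → Point m → Set
ProperFace S a = ∃ λ w → ∃ λ v → S w × S v × (dot a w ℤ.< dot a v)

-- the face exposed by a is a facet: a maximal proper face
-- (faces of conv S are determined by the points of S they contain)
Facet : {m : ℕ} → PointSet m → Point m → Set
Facet S a = ProperFace S a ×
  (∀ b → ProperFace S b → (∀ v → OnFace S a v → OnFace S b v) →
                           (∀ v → OnFace S b v → OnFace S a v))

RelInt : {m : ℕ} → PointSet m → Point m → Set
RelInt S p = InConv S p ×
  (∀ a → ProperFace S a → ∃ λ v → S v × (dot a p ℤ.< dot a v))

-- Reflexive lattice polytope conv(S) (not necessarily full-dimensional):
-- some lattice point p in the relative interior such that for every facet
-- F (exposed by a, with value c = ⟨a,v⟩ for v ∈ F) no lattice point x of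
-- aff(conv S) satisfies ⟨a,p⟩ < ⟨a,x⟩ < c, i.e. lies strictly between
-- aff(F) and its parallel translate through p inside aff(conv S).
Reflexive : {m : ℕ} → PointSet m → Set
Reflexive S = ∃ λ p → RelInt S p ×
  (∀ a → Facet S a → ∀ v → MaxAt S a v → ∀ x → InAff S x →
     ¬ ((dot a p ℤ.< dot a x) × (dot a x ℤ.< dot a v)))

IsPartition : {m : ℕ} → (Fin m → ℕ) → Set
IsPartition {m} lam = ∀ (i j : Fin m) → i Fin.≤ j → lam j ℕ.≤ lam i

-- exponent vectors of the S_m-orbit of (λ₁,…,λ_m); Newt(s_λ) = conv(orbit)
Orbit : {m : ℕ} → (Fin m → ℕ) → PointSet m
Orbit {m} lam v = ∃ λ (σ : Permutation′ m) → ∀ i → v i ≡ + lam (σ ⟨$⟩ʳ i)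

reduce : {k : ℕ} → (Fin (suc (suc k)) → ℕ) → Fin (suc (suc k)) → ℕ
reduce {k} lam i = lam i ∸ lam (Fin.fromℕ (suc k))

fam1 : (m : ℕ) → Fin m → ℕ
fam1 m i = if toℕ i ≡ᵇ 0 then m else 0

fam2 : (m : ℕ) → Fin m → ℕ
fam2 m i = if toℕ i ≡ᵇ 0 then 2 else (if suc (toℕ i) ≡ᵇ m then 0 else 1)

fam3 : (m : ℕ) → Fin m → ℕ
fam3 m i = if toℕ i <ᵇ m / 2 then 2 else 0

-- (2, …, 2, 1, 0, …, 0) with (m-1)/2 twos (used when m is odd; (m-1)/2 = ⌊m/2⌋)
fam4 : (m : ℕ) → Fin m → ℕ
fam4 m i = if toℕ i <ᵇ m / 2 then 2 else (if toℕ i ≡ᵇ m / 2 then 1 else 0)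

fam5 : (m : ℕ) → Fin m → ℕ
fam5 m i = if suc (toℕ i) <ᵇ m then m else 0

_≗_ : {m : ℕ} → (Fin m → ℕ) → (Fin m → ℕ) → Set
f ≗ g = ∀ i → f i ≡ g i

InList : (m : ℕ) → (Fin m → ℕ) → Set
InList m μ = (μ ≗ fam1 m)
           ⊎ (μ ≗ fam2 m)
           ⊎ ((m % 2 ≡ 0) × (μ ≗ fam3 m))
           ⊎ ((m % 2 ≡ 1) × (μ ≗ fam4 m))
           ⊎ (μ ≗ fam5 m)

module Submission where

open import Defs

module Permutohedra where

  open import Data.Nat as ℕ using (ℕ; zero; suc; _<ᵇ_; _≡ᵇ_)
  import Data.Nat.Properties as ℕP
  open import Data.Nat.DivMod using (_/_; m*n%n≡0; m*n/n≡m; [m+kn]%n≡m%n; +-distrib-/; m≡m%n+[m/n]*n; _%_; m%n<n; %-distribˡ-+; m%n%n≡m%n; [m+n]%n≡m%n; m<n⇒m%n≡m)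
  open import Data.Integer as ℤ using (ℤ; +_; _+_; _*_; _-_; -_; _≤_; _<_)
  import Data.Integer.Properties as ℤP
  open import Data.Integer.Tactic.RingSolver using (solve-∀)
  open import Data.Fin as Fin using (Fin; toℕ)
  import Data.Fin.Properties as FinP
  open import Data.Fin.Permutation as Perm using (Permutation′; _⟨$⟩ʳ_; _⟨$⟩ˡ_)
  import Data.Nat.Coprimality as Coprimality
  open import Data.Rational as ℚ using (ℚ; mkℚ; 0ℚ; 1ℚ)
  import Data.Rational.Properties as ℚP
  open import Data.Rational.Solver using (module +-*-Solver)
  open import Data.List using (List; []; _∷_; _++_; tabulate)
  open import Data.Product using (Σ; ∃; _×_; _,_; proj₁; proj₂)
  open import Data.Sum using (_⊎_; inj₁; inj₂; [_,_])
  open import Data.Empty using (⊥-elim; ⊥)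
  open import Data.Unit using (tt)
  open import Data.Bool using (true; false; if_then_else_; T)
  open import Relation.Binary.PropositionalEquality hiding (_≗_)
  open import Relation.Nullary using (¬_; Dec; yes; no; ¬?)
  import Algebra.Properties.CommutativeMonoid.Sum as MonoidSum
  open import Function using (_∘_)
  open import Relation.Nullary.Decidable using (decidable-stable)
  open import Relation.Binary.Definitions using (tri<; tri≈; tri>)

  private
    variable
      m : ℕ

  sum-cong : {f g : Fin m → ℤ} → (∀ i → f i ≡ g i) → sumFinℤ m f ≡ sumFinℤ m g
  sum-cong {zero}  h = refl
  sum-cong {suc m} h = cong₂ _+_ (h Fin.zero) (sum-cong (h ∘ Fin.suc))

  sum-+ : (f g : Fin m → ℤ) → sumFinℤ m (λ i → f i + g i) ≡ sumFinℤ m f + sumFinℤ m g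
  sum-+ {zero}  f g = refl
  sum-+ {suc m} f g rewrite sum-+ (λ i → f (Fin.suc i)) (λ i → g (Fin.suc i)) = swap-middle (f Fin.zero) (g Fin.zero) _ _
    where
    swap-middle : ∀ a b c d → a + b + (c + d) ≡ a + c + (b + d)
    swap-middle = solve-∀

  sum-*ˡ : (c : ℤ) (f : Fin m → ℤ) → sumFinℤ m (λ i → c * f i) ≡ c * sumFinℤ m f
  sum-*ˡ {zero}  c f = sym (ℤP.*-zeroʳ c)
  sum-*ˡ {suc m} c f rewrite sum-*ˡ c (f ∘ Fin.suc) = sym (ℤP.*-distribˡ-+ c (f Fin.zero) _)

  sum-neg : (f : Fin m → ℤ) → sumFinℤ m (λ i → - f i) ≡ - sumFinℤ m f
  sum-neg {zero}  f = refl
  sum-neg {suc m} f rewrite sum-neg (f ∘ Fin.suc) = sym (ℤP.neg-distrib-+ (f Fin.zero) _)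

  sum-- : (f g : Fin m → ℤ) → sumFinℤ m (λ i → f i - g i) ≡ sumFinℤ m f - sumFinℤ m g
  sum-- f g = trans (sum-+ f (λ i → - g i)) (cong (λ s → sumFinℤ _ f + s) (sum-neg g))

  sum-const : ∀ m (c : ℤ) → sumFinℤ m (λ _ → c) ≡ + m * c
  sum-const zero    c = sym (ℤP.*-zeroˡ c)
  sum-const (suc m) c rewrite sum-const m c = succ-* c (+ m)
    where
    succ-* : ∀ c x → c + x * c ≡ (+ 1 + x) * c
    succ-* = solve-∀

  sum-zero : (f : Fin m → ℤ) → (∀ i → f i ≡ + 0) → sumFinℤ m f ≡ + 0
  sum-zero {m} f h = trans (sum-cong h) (trans (sum-const m (+ 0)) (ℤP.*-zeroʳ (+ m)))

  sum-mono-≤ : {f g : Fin m → ℤ} → (∀ i → f i ≤ g i) → sumFinℤ m f ≤ sumFinℤ m g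
  sum-mono-≤ {zero}  h = ℤP.≤-refl
  sum-mono-≤ {suc m} h = ℤP.+-mono-≤ (h Fin.zero) (sum-mono-≤ (h ∘ Fin.suc))

  sum-mono-< : {f g : Fin m → ℤ} → (∀ i → f i ≤ g i) → ∀ j → f j < g j → sumFinℤ m f < sumFinℤ m g
  sum-mono-< {suc m} h Fin.zero    lt = ℤP.+-mono-<-≤ lt (sum-mono-≤ (h ∘ Fin.suc))
  sum-mono-< {suc m} h (Fin.suc j) lt = ℤP.+-mono-≤-< (h Fin.zero) (sum-mono-< (h ∘ Fin.suc) j lt)

  sum-mono-≤-≡⇒≡ : {f g : Fin m → ℤ} → (∀ i → f i ≤ g i) → sumFinℤ m f ≡ sumFinℤ m g → ∀ i → f i ≡ g i
  sum-mono-≤-≡⇒≡ {f = f} {g} h e i with f i ℤ.≟ g i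
  ... | yes fi≡gi = fi≡gi
  ... | no  fi≢gi = ⊥-elim (ℤP.<-irrefl e (sum-mono-< h i (ℤP.≤∧≢⇒< (h i) fi≢gi)))

  private
    module Σℤ = MonoidSum ℤP.+-0-commutativeMonoid

    sum≡∑ : (f : Fin m → ℤ) → sumFinℤ m f ≡ Σℤ.sum f
    sum≡∑ {zero}  f = refl
    sum≡∑ {suc m} f = cong (λ s → f Fin.zero + s) (sum≡∑ (f ∘ Fin.suc))

  sum-permute : (f : Fin m → ℤ) (π : Permutation′ m) → sumFinℤ m (λ i → f (π ⟨$⟩ʳ i)) ≡ sumFinℤ m f
  sum-permute f π = trans (sum≡∑ (λ i → f (π ⟨$⟩ʳ i))) (trans (sym (Σℤ.sum-permute f π)) (sym (sum≡∑ f)))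

  sum-comm : ∀ {k} (f : Fin m → Fin k → ℤ) →
    sumFinℤ m (λ i → sumFinℤ k (f i)) ≡ sumFinℤ k (λ j → sumFinℤ m (λ i → f i j))
  sum-comm {m} {k} f = begin
    sumFinℤ m (λ i → sumFinℤ k (f i))     ≡⟨ trans (sum-cong (λ i → sum≡∑ (f i))) (sum≡∑ (λ i → Σℤ.sum (f i))) ⟩
    Σℤ.sum (λ i → Σℤ.sum (f i))           ≡⟨ Σℤ.∑-comm f ⟩
    Σℤ.sum (λ j → Σℤ.sum (λ i → f i j))   ≡⟨ sym (trans (sum-cong (λ j → sum≡∑ (λ i → f i j))) (sum≡∑ (λ j → Σℤ.sum (λ i → f i j)))) ⟩
    sumFinℤ k (λ j → sumFinℤ m (λ i → f i j)) ∎
    where open ≡-Reasoning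

  δ : Fin m → Point m
  δ Fin.zero    Fin.zero    = + 1
  δ Fin.zero    (Fin.suc j) = + 0
  δ (Fin.suc i) Fin.zero    = + 0
  δ (Fin.suc i) (Fin.suc j) = δ i j

  δ-diag : (i : Fin m) → δ i i ≡ + 1
  δ-diag Fin.zero    = refl
  δ-diag (Fin.suc i) = δ-diag i

  δ-off : (i j : Fin m) → i ≢ j → δ i j ≡ + 0
  δ-off Fin.zero    Fin.zero    i≢j = ⊥-elim (i≢j refl)
  δ-off Fin.zero    (Fin.suc j) i≢j = refl
  δ-off (Fin.suc i) Fin.zero    i≢j = refl
  δ-off (Fin.suc i) (Fin.suc j) i≢j = δ-off i j (i≢j ∘ cong Fin.suc)

  sum-δ-* : (i : Fin m) (f : Fin m → ℤ) → sumFinℤ m (λ l → δ i l * f l) ≡ f i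
  sum-δ-* {suc m} Fin.zero    f = begin
    + 1 * f Fin.zero + sumFinℤ m (λ l → + 0 * f (Fin.suc l))
      ≡⟨ cong₂ _+_ (ℤP.*-identityˡ (f Fin.zero)) (sum-zero _ (λ l → ℤP.*-zeroˡ (f (Fin.suc l)))) ⟩
    f Fin.zero + + 0 ≡⟨ ℤP.+-identityʳ _ ⟩
    f Fin.zero ∎
    where open ≡-Reasoning
  sum-δ-* {suc m} (Fin.suc i) f = begin
    + 0 * f Fin.zero + sumFinℤ m (λ l → δ i l * f (Fin.suc l))
      ≡⟨ cong₂ _+_ (ℤP.*-zeroˡ (f Fin.zero)) (sum-δ-* i (f ∘ Fin.suc)) ⟩
    + 0 + f (Fin.suc i) ≡⟨ ℤP.+-identityˡ _ ⟩
    f (Fin.suc i) ∎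
    where open ≡-Reasoning

  sum-δ : (i : Fin m) → sumFinℤ m (δ i) ≡ + 1
  sum-δ i = trans (sum-cong (λ l → sym (ℤP.*-identityʳ (δ i l)))) (sum-δ-* i (λ _ → + 1))

  root : Fin m → Fin m → Point m
  root i j l = δ i l - δ j l

  dot-comm : (a x : Point m) → dot a x ≡ dot x a
  dot-comm a x = sum-cong (λ l → ℤP.*-comm (a l) (x l))

  dot-δˡ : (i : Fin m) (x : Point m) → dot (δ i) x ≡ x i
  dot-δˡ = sum-δ-*

  dot-δʳ : (a : Point m) (i : Fin m) → dot a (δ i) ≡ a i
  dot-δʳ a i = trans (dot-comm a (δ i)) (dot-δˡ i a)

  dot-constˡ : (c : ℤ) (x : Point m) → dot (λ _ → c) x ≡ c * sumFinℤ m x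
  dot-constˡ = sum-*ˡ

  dot-+ˡ : (a b x : Point m) → dot (λ l → a l + b l) x ≡ dot a x + dot b x
  dot-+ˡ a b x = trans (sum-cong (λ l → ℤP.*-distribʳ-+ (x l) (a l) (b l))) (sum-+ (λ l → a l * x l) (λ l → b l * x l))

  dot-*ˡ : (c : ℤ) (a x : Point m) → dot (λ l → c * a l) x ≡ c * dot a x
  dot-*ˡ c a x = trans (sum-cong (λ l → ℤP.*-assoc c (a l) (x l))) (sum-*ˡ c (λ l → a l * x l))

  dot-+ʳ : (a x y : Point m) → dot a (λ l → x l + y l) ≡ dot a x + dot a y
  dot-+ʳ a x y = trans (sum-cong (λ l → ℤP.*-distribˡ-+ (a l) (x l) (y l))) (sum-+ (λ l → a l * x l) (λ l → a l * y l))

  dot-*ʳ : (a : Point m) (c : ℤ) (x : Point m) → dot a (λ l → c * x l) ≡ c * dot a x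
  dot-*ʳ a c x = trans (dot-comm a (λ l → c * x l)) (trans (dot-*ˡ c x a) (cong (c *_) (dot-comm x a)))

  dot-rootʳ : (a : Point m) (i j : Fin m) → dot a (root i j) ≡ a i - a j
  dot-rootʳ {m} a i j = begin
    dot a (root i j)                 ≡⟨ sum-cong (λ l → ℤP.*-distribˡ-+ (a l) (δ i l) (- δ j l)) ⟩
    sumFinℤ m (λ l → a l * δ i l + a l * - δ j l)
      ≡⟨ trans (sum-+ (λ l → a l * δ i l) (λ l → a l * - δ j l))
               (cong (λ s → dot a (δ i) + s) (trans (sum-cong (λ l → sym (ℤP.neg-distribʳ-* (a l) (δ j l))))
                                                     (sum-neg (λ l → a l * δ j l)))) ⟩
    dot a (δ i) - dot a (δ j)        ≡⟨ cong₂ _-_ (dot-δʳ a i) (dot-δʳ a j) ⟩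
    a i - a j ∎
    where open ≡-Reasoning

  dot-affine : ∀ {a χ : Point m} h g → (∀ l → a l ≡ h + g * χ l) → ∀ w → dot a w ≡ h * sumFinℤ m w + g * dot χ w
  dot-affine {m} {a} {χ} h g a≡ w = begin
    dot a w                                  ≡⟨ sum-cong (λ l → cong (_* w l) (a≡ l)) ⟩
    dot (λ l → h + g * χ l) w                ≡⟨ dot-+ˡ (λ _ → h) (λ l → g * χ l) w ⟩
    dot (λ _ → h) w + dot (λ l → g * χ l) w  ≡⟨ cong₂ _+_ (dot-constˡ h w) (dot-*ˡ g χ w) ⟩
    h * sumFinℤ m w + g * dot χ w ∎
    where open ≡-Reasoning

  module _ {m : ℕ} (i j : Fin m) where

    private
      τ = Perm.transpose i j

    transpose-matchˡ : τ ⟨$⟩ʳ i ≡ j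
    transpose-matchˡ with i FinP.≟ i
    ... | yes _   = refl
    ... | no  i≢i = ⊥-elim (i≢i refl)

    transpose-matchʳ : τ ⟨$⟩ʳ j ≡ i
    transpose-matchʳ with j FinP.≟ i
    ... | yes j≡i = j≡i
    ... | no  _ with j FinP.≟ j
    ...   | yes _   = refl
    ...   | no  j≢j = ⊥-elim (j≢j refl)

    transpose-other : ∀ {k} → k ≢ i → k ≢ j → τ ⟨$⟩ʳ k ≡ k
    transpose-other {k} k≢i k≢j with k FinP.≟ i
    ... | yes k≡i = ⊥-elim (k≢i k≡i)
    ... | no  _ with k FinP.≟ j
    ...   | yes k≡j = ⊥-elim (k≢j k≡j)
    ...   | no  _   = refl

    transpose-≡-+-root : (v : Point m) (l : Fin m) → v (τ ⟨$⟩ʳ l) ≡ v l + (v j - v i) * root i j l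
    transpose-≡-+-root v l = by-cases (l FinP.≟ i) (l FinP.≟ j)
      where
      by-cases : Dec (l ≡ i) → Dec (l ≡ j) → v (τ ⟨$⟩ʳ l) ≡ v l + (v j - v i) * root i j l
      by-cases (yes refl) (yes refl) rewrite transpose-matchˡ | δ-diag l = fixed (v l)
        where
        fixed : ∀ x → x ≡ x + (x - x) * (+ 1 - + 1)
        fixed = solve-∀
      by-cases (yes refl) (no l≢j) rewrite transpose-matchˡ | δ-diag l | δ-off j l (l≢j ∘ sym) = moved (v l) (v j)
        where
        moved : ∀ x y → y ≡ x + (y - x) * (+ 1 - + 0)
        moved = solve-∀
      by-cases (no l≢i) (yes refl) rewrite transpose-matchʳ | δ-diag l | δ-off i l (l≢i ∘ sym) = moved (v l) (v i)
        where
        moved : ∀ x y → y ≡ x + (x - y) * (+ 0 - + 1)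
        moved = solve-∀
      by-cases (no l≢i) (no l≢j) rewrite transpose-other l≢i l≢j | δ-off i l (l≢i ∘ sym) | δ-off j l (l≢j ∘ sym) =
        fixed (v l) (v j - v i)
        where
        fixed : ∀ x c → x ≡ x + c * (+ 0 - + 0)
        fixed = solve-∀

    dot-transpose : (a v : Point m) → dot a (λ l → v (τ ⟨$⟩ʳ l)) ≡ dot a v + (a i - a j) * (v j - v i)
    dot-transpose a v = begin
      dot a (λ l → v (τ ⟨$⟩ʳ l))                  ≡⟨ sum-cong (λ l → cong (a l *_) (transpose-≡-+-root v l)) ⟩
      dot a (λ l → v l + (v j - v i) * root i j l) ≡⟨ dot-+ʳ a v _ ⟩
      dot a v + dot a (λ l → (v j - v i) * root i j l) ≡⟨ cong (λ s → dot a v + s) (dot-*ʳ a (v j - v i) (root i j)) ⟩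
      dot a v + (v j - v i) * dot a (root i j)    ≡⟨ cong (λ s → dot a v + (v j - v i) * s) (dot-rootʳ a i j) ⟩
      dot a v + (v j - v i) * (a i - a j)         ≡⟨ cong (λ s → dot a v + s) (ℤP.*-comm (v j - v i) (a i - a j)) ⟩
      dot a v + (a i - a j) * (v j - v i) ∎
      where open ≡-Reasoning

  dot-transpose-level : (c v : Point m) (l j : Fin m) → c l ≡ c j →
    dot c (λ i → v (Perm.transpose l j ⟨$⟩ʳ i)) ≡ dot c v
  dot-transpose-level c v l j cl≡cj = trans (dot-transpose l j c v) (vanish (dot c v) (c l) (c j) (v j - v l) cl≡cj)
    where
    vanish : ∀ d x y z → x ≡ y → d + (x - y) * z ≡ d
    vanish d x y z refl = trans (cong (λ s → d + s * z) (ℤP.+-inverseʳ x)) (ℤP.+-identityʳ d)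

  coprime-1 : ∀ n → Coprimality.Coprime n 1
  coprime-1 n = Coprimality.sym (Coprimality.1-coprimeTo n)

  toℚ-mkℚ : ∀ z → toℚ z ≡ mkℚ z 0 (coprime-1 ℤ.∣ z ∣)
  toℚ-mkℚ (+ n)      = ℚP.normalize-coprime (coprime-1 n)
  toℚ-mkℚ ℤ.-[1+ n ] = cong ℚ.-_ (ℚP.normalize-coprime (coprime-1 (suc n)))

  toℚ-injective : ∀ {a b} → toℚ a ≡ toℚ b → a ≡ b
  toℚ-injective {a} {b} e = cong ℚ.↥_ (trans (sym (toℚ-mkℚ a)) (trans e (toℚ-mkℚ b)))

  toℚ-+ : ∀ a b → toℚ (a + b) ≡ toℚ a ℚ.+ toℚ b
  toℚ-+ a b rewrite toℚ-mkℚ a | toℚ-mkℚ b = cong toℚ (cong₂ _+_ (sym (ℤP.*-identityʳ a)) (sym (ℤP.*-identityʳ b)))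

  toℚ-* : ∀ a b → toℚ (a * b) ≡ toℚ a ℚ.* toℚ b
  toℚ-* a b rewrite toℚ-mkℚ a | toℚ-mkℚ b = refl

  toℚ-neg : ∀ a → toℚ (- a) ≡ ℚ.- toℚ a
  toℚ-neg a rewrite toℚ-mkℚ a | toℚ-mkℚ (- a) = mkℚ-neg a
    where
    mkℚ-neg : ∀ a → mkℚ (- a) 0 (coprime-1 ℤ.∣ - a ∣) ≡ ℚ.- mkℚ a 0 (coprime-1 ℤ.∣ a ∣)
    mkℚ-neg (+ zero)    = refl
    mkℚ-neg (+ suc n)   = refl
    mkℚ-neg ℤ.-[1+ n ] = refl

  toℚ-- : ∀ a b → toℚ (a - b) ≡ toℚ a ℚ.- toℚ b
  toℚ-- a b = trans (toℚ-+ a (- b)) (cong (toℚ a ℚ.+_) (toℚ-neg b))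

  sumℚ : ∀ m → (Fin m → ℚ) → ℚ
  sumℚ zero    f = 0ℚ
  sumℚ (suc m) f = f Fin.zero ℚ.+ sumℚ m (f ∘ Fin.suc)

  sumℚ-cong : {f g : Fin m → ℚ} → (∀ i → f i ≡ g i) → sumℚ m f ≡ sumℚ m g
  sumℚ-cong {zero}  h = refl
  sumℚ-cong {suc m} h = cong₂ ℚ._+_ (h Fin.zero) (sumℚ-cong (h ∘ Fin.suc))

  sumℚ-+ : (f g : Fin m → ℚ) → sumℚ m (λ i → f i ℚ.+ g i) ≡ sumℚ m f ℚ.+ sumℚ m g
  sumℚ-+ {zero}  f g = sym (ℚP.+-identityʳ 0ℚ)
  sumℚ-+ {suc m} f g rewrite sumℚ-+ (f ∘ Fin.suc) (g ∘ Fin.suc) =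
    solve 4 (λ a b c d → (a :+ b) :+ (c :+ d) := (a :+ c) :+ (b :+ d)) refl
      (f Fin.zero) (g Fin.zero) (sumℚ m (f ∘ Fin.suc)) (sumℚ m (g ∘ Fin.suc))
    where open +-*-Solver

  sumℚ-*ˡ : (c : ℚ) (f : Fin m → ℚ) → sumℚ m (λ i → c ℚ.* f i) ≡ c ℚ.* sumℚ m f
  sumℚ-*ˡ {zero}  c f = sym (ℚP.*-zeroʳ c)
  sumℚ-*ˡ {suc m} c f rewrite sumℚ-*ˡ c (f ∘ Fin.suc) = sym (ℚP.*-distribˡ-+ c (f Fin.zero) _)

  sumℚ-toℚ : (x : Fin m → ℤ) → sumℚ m (λ i → toℚ (x i)) ≡ toℚ (sumFinℤ m x)
  sumℚ-toℚ {zero}  x = refl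
  sumℚ-toℚ {suc m} x rewrite sumℚ-toℚ (x ∘ Fin.suc) = sym (toℚ-+ (x Fin.zero) _)

  sumℚ-const : ∀ m (x : ℚ) → sumℚ m (λ _ → x) ≡ toℚ (+ m) ℚ.* x
  sumℚ-const zero    x = sym (ℚP.*-zeroˡ x)
  sumℚ-const (suc m) x = begin
    x ℚ.+ sumℚ m (λ _ → x)           ≡⟨ cong (x ℚ.+_) (sumℚ-const m x) ⟩
    x ℚ.+ toℚ (+ m) ℚ.* x            ≡⟨ solve 2 (λ x t → x :+ t :* x := (con 1ℚ :+ t) :* x) refl x (toℚ (+ m)) ⟩
    (1ℚ ℚ.+ toℚ (+ m)) ℚ.* x         ≡⟨ cong (ℚ._* x) (sym (toℚ-+ (+ 1) (+ m))) ⟩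
    toℚ (+ suc m) ℚ.* x ∎
    where
    open ≡-Reasoning
    open +-*-Solver

  module _ {m : ℕ} {S : PointSet m} where

    combo-++ : (fs gs : Family S) (i : Fin m) → combo (fs ++ gs) i ≡ combo fs i ℚ.+ combo gs i
    combo-++ []                  gs i = sym (ℚP.+-identityˡ _)
    combo-++ ((q , v , _) ∷ fs) gs i rewrite combo-++ fs gs i =
      sym (ℚP.+-assoc (q ℚ.* toℚ (v i)) (combo fs i) (combo gs i))

    weightSum-++ : (fs gs : Family S) → weightSum (fs ++ gs) ≡ weightSum fs ℚ.+ weightSum gs
    weightSum-++ []             gs = sym (ℚP.+-identityˡ _)
    weightSum-++ ((q , _) ∷ fs) gs rewrite weightSum-++ fs gs = sym (ℚP.+-assoc q (weightSum fs) (weightSum gs))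

    combo-tabulate : ∀ {k} (F : Fin k → ℚ × Σ (Point m) S) (i : Fin m) →
      combo (tabulate F) i ≡ sumℚ k (λ r → proj₁ (F r) ℚ.* toℚ (proj₁ (proj₂ (F r)) i))
    combo-tabulate {zero}  F i = refl
    combo-tabulate {suc k} F i = cong (proj₁ (F Fin.zero) ℚ.* toℚ (proj₁ (proj₂ (F Fin.zero)) i) ℚ.+_)
                                      (combo-tabulate (F ∘ Fin.suc) i)

    weightSum-tabulate : ∀ {k} (F : Fin k → ℚ × Σ (Point m) S) → weightSum (tabulate F) ≡ sumℚ k (proj₁ ∘ F)
    weightSum-tabulate {zero}  F = refl
    weightSum-tabulate {suc k} F = cong (proj₁ (F Fin.zero) ℚ.+_) (weightSum-tabulate (F ∘ Fin.suc))

    allNonneg-tabulate : ∀ {k} (F : Fin k → ℚ × Σ (Point m) S) → (∀ r → 0ℚ ℚ.≤ proj₁ (F r)) →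
      AllNonneg (tabulate F)
    allNonneg-tabulate {zero}  F h = tt
    allNonneg-tabulate {suc k} F h = h Fin.zero , allNonneg-tabulate (F ∘ Fin.suc) (h ∘ Fin.suc)

  module Rotation (n-1 : ℕ) where

    private
      n = suc n-1

      %-absorbˡ : ∀ a b → ((a % n) ℕ.+ b) % n ≡ (a ℕ.+ b) % n
      %-absorbˡ a b = begin
        (a % n ℕ.+ b) % n              ≡⟨ %-distribˡ-+ (a % n) b n ⟩
        (a % n % n ℕ.+ b % n) % n      ≡⟨ cong (λ z → (z ℕ.+ b % n) % n) (m%n%n≡m%n a n) ⟩
        (a % n ℕ.+ b % n) % n          ≡⟨ sym (%-distribˡ-+ a b n) ⟩
        (a ℕ.+ b) % n ∎
        where open ≡-Reasoning

      +n%n : (i : Fin n) → (toℕ i ℕ.+ n) % n ≡ toℕ i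
      +n%n i = trans ([m+n]%n≡m%n (toℕ i) n) (m<n⇒m%n≡m (FinP.toℕ<n i))

      _⊕_ : Fin n → ℕ → Fin n
      i ⊕ r = Fin.fromℕ< (m%n<n (toℕ i ℕ.+ r) n)

      toℕ-⊕ : ∀ i r → toℕ (i ⊕ r) ≡ (toℕ i ℕ.+ r) % n
      toℕ-⊕ i r = FinP.toℕ-fromℕ< _

      ⊕-⊕-inverse : ∀ i r s → r ℕ.+ s ≡ n → (i ⊕ r) ⊕ s ≡ i
      ⊕-⊕-inverse i r s r+s≡n = FinP.toℕ-injective (begin
        toℕ ((i ⊕ r) ⊕ s)              ≡⟨ trans (toℕ-⊕ (i ⊕ r) s) (cong (λ z → (z ℕ.+ s) % n) (toℕ-⊕ i r)) ⟩
        ((toℕ i ℕ.+ r) % n ℕ.+ s) % n  ≡⟨ %-absorbˡ (toℕ i ℕ.+ r) s ⟩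
        (toℕ i ℕ.+ r ℕ.+ s) % n        ≡⟨ cong (_% n) (trans (ℕP.+-assoc (toℕ i) r s) (cong (toℕ i ℕ.+_) r+s≡n)) ⟩
        (toℕ i ℕ.+ n) % n              ≡⟨ +n%n i ⟩
        toℕ i ∎)
        where open ≡-Reasoning

      r≤n : (r : Fin n) → toℕ r ℕ.≤ n
      r≤n r = ℕP.<⇒≤ (FinP.toℕ<n r)

    rotate : Fin n → Permutation′ n
    rotate r = Perm.permutation (_⊕ toℕ r) (_⊕ (n ℕ.∸ toℕ r))
      (λ i → ⊕-⊕-inverse i (n ℕ.∸ toℕ r) (toℕ r) (ℕP.m∸n+n≡m (r≤n r)))
      (λ i → ⊕-⊕-inverse i (toℕ r) (n ℕ.∸ toℕ r) (ℕP.m+[n∸m]≡n (r≤n r)))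

    rotate-zero : ∀ i → rotate Fin.zero ⟨$⟩ʳ i ≡ i
    rotate-zero i = FinP.toℕ-injective (trans (toℕ-⊕ i 0)
      (trans (cong (_% n) (ℕP.+-identityʳ (toℕ i))) (m<n⇒m%n≡m (FinP.toℕ<n i))))

    rotate-comm : ∀ r i → rotate r ⟨$⟩ʳ i ≡ rotate i ⟨$⟩ʳ r
    rotate-comm r i = FinP.toℕ-injective (trans (toℕ-⊕ i (toℕ r))
      (trans (cong (_% n) (ℕP.+-comm (toℕ i) (toℕ r))) (sym (toℕ-⊕ r (toℕ i)))))

    -- each coordinate runs once through every position as the rotation varies
    sum-rotate : (f : Fin n → ℤ) (i : Fin n) → sumFinℤ n (λ r → f (rotate r ⟨$⟩ʳ i)) ≡ sumFinℤ n f
    sum-rotate f i = trans (sum-cong (λ r → cong f (rotate-comm r i))) (sum-permute f (rotate i))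

  argmax : ∀ {n} (f : Fin (suc n) → ℤ) → ∃ λ i → ∀ j → f j ≤ f i
  argmax {zero}  f = Fin.zero , λ { Fin.zero → ℤP.≤-refl }
  argmax {suc n} f with argmax (f ∘ Fin.suc)
  ... | i , fj≤fi with f (Fin.suc i) ℤ.≤? f Fin.zero
  ...   | yes fi≤f0 = Fin.zero , λ { Fin.zero → ℤP.≤-refl ; (Fin.suc j) → ℤP.≤-trans (fj≤fi j) fi≤f0 }
  ...   | no  fi≰f0 = Fin.suc i , λ { Fin.zero → ℤP.<⇒≤ (ℤP.≰⇒> fi≰f0) ; (Fin.suc j) → fj≤fi j }

  argmin : ∀ {n} (f : Fin (suc n) → ℤ) → ∃ λ i → ∀ j → f i ≤ f j
  argmin f with argmax (λ i → - f i)
  ... | i , -fj≤-fi = i , λ j → ℤP.neg-cancel-≤ (-fj≤-fi j)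

  Binary : Point m → Set
  Binary χ = ∀ i → χ i ≡ + 0 ⊎ χ i ≡ + 1

  module _ {χ : Point m} (χ-binary : Binary χ) where

    binary-nonneg : ∀ i → + 0 ≤ χ i
    binary-nonneg i with χ-binary i
    ... | inj₁ χi≡0 rewrite χi≡0 = ℤP.≤-refl
    ... | inj₂ χi≡1 rewrite χi≡1 = ℤ.+≤+ ℕ.z≤n

    binary-≤1 : ∀ i → χ i ≤ + 1
    binary-≤1 i with χ-binary i
    ... | inj₁ χi≡0 rewrite χi≡0 = ℤ.+≤+ ℕ.z≤n
    ... | inj₂ χi≡1 rewrite χi≡1 = ℤP.≤-refl

    binary-≢1 : ∀ i → χ i ≢ + 1 → χ i ≡ + 0
    binary-≢1 i χi≢1 with χ-binary i
    ... | inj₁ χi≡0 = χi≡0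
    ... | inj₂ χi≡1 = ⊥-elim (χi≢1 χi≡1)

    binary-≢0 : ∀ i → χ i ≢ + 0 → χ i ≡ + 1
    binary-≢0 i χi≢0 with χ-binary i
    ... | inj₁ χi≡0 = ⊥-elim (χi≢0 χi≡0)
    ... | inj₂ χi≡1 = χi≡1

    binary-*-mono : ∀ i {x y} → x ≤ y → χ i * x ≤ χ i * y
    binary-*-mono i = ℤP.*-monoˡ-≤-nonNeg (χ i) {{ℤ.nonNegative (binary-nonneg i)}}

    binary-1≤sum : ∀ i → χ i ≡ + 1 → + 1 ≤ sumFinℤ m χ
    binary-1≤sum i χi≡1 = subst (_≤ sumFinℤ m χ) (sum-δ i) (sum-mono-≤ δ≤χ)
      where
      δ≤χ : ∀ l → δ i l ≤ χ l
      δ≤χ l with l FinP.≟ i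
      ... | yes refl rewrite δ-diag l | χi≡1 = ℤP.≤-refl
      ... | no  l≢i rewrite δ-off i l (l≢i ∘ sym) = binary-nonneg l

    binary-one : + 1 ≤ sumFinℤ m χ → ∃ λ i → χ i ≡ + 1
    binary-one 1≤∑χ with FinP.any? (λ i → χ i ℤ.≟ + 1)
    ... | yes one = one
    ... | no  none = ⊥-elim (ℤP.<-irrefl refl (ℤP.<-≤-trans (ℤ.+<+ (ℕ.s≤s ℕ.z≤n)) ∑χ≤0))
      where
      ∑χ≤0 : + 1 ≤ + 0
      ∑χ≤0 = subst (+ 1 ≤_) (sum-zero χ (λ i → binary-≢1 i (λ χi≡1 → none (i , χi≡1)))) 1≤∑χ

  <-+1 : ∀ a → a < a + + 1
  <-+1 a = ℤP.suc[i]≤j⇒i<j (ℤP.≤-reflexive (ℤP.+-comm (+ 1) a))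

  ≤-1⇒< : ∀ {a b} → a ≤ b - + 1 → a < b
  ≤-1⇒< {a} {b} a≤b-1 = ℤP.i≤pred[j]⇒i<j (subst (a ≤_) (ℤP.+-comm b (- + 1)) a≤b-1)

  <⇒+1≤ : ∀ {a b} → a < b → a + + 1 ≤ b
  <⇒+1≤ {a} a<b = subst (_≤ _) (ℤP.+-comm (+ 1) a) (ℤP.i<j⇒suc[i]≤j a<b)

  0<-diff : ∀ {a b} → a < b → + 0 < b - a
  0<-diff {a} {b} a<b = subst (_< b - a) (ℤP.+-inverseʳ a) (ℤP.+-monoˡ-< (- a) a<b)

  0<-diff⁻¹ : ∀ {a b} → + 0 < b - a → a < b
  0<-diff⁻¹ {a} {b} 0<b-a = subst₂ _<_ (ℤP.+-identityˡ a) (restore a b) (ℤP.+-monoˡ-< a 0<b-a)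
    where
    restore : ∀ a b → b - a + a ≡ b
    restore = solve-∀

  0<-* : ∀ {x y} → + 0 < x → + 0 < y → + 0 < x * y
  0<-* {x} {y} 0<x 0<y = subst (_< x * y) (ℤP.*-zeroʳ x) (ℤP.*-monoˡ-<-pos x {{ℤ.positive 0<x}} 0<y)

  argmin-where : ∀ {n} {p} {P : Fin n → Set p} → (∀ i → Dec (P i)) → (f : Fin n → ℤ) →
    (∀ j → ¬ P j) ⊎ (∃ λ i → P i × (∀ j → P j → f i ≤ f j))
  argmin-where {zero}  P? f = inj₁ (λ ())
  argmin-where {suc n} P? f with argmin-where (P? ∘ Fin.suc) (f ∘ Fin.suc) | P? Fin.zero
  ... | inj₁ none | no ¬p0 = inj₁ λ { Fin.zero p0 → ¬p0 p0 ; (Fin.suc j) pj → none j pj }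
  ... | inj₁ none | yes p0 = inj₂ (Fin.zero , p0 , λ { Fin.zero _ → ℤP.≤-refl ; (Fin.suc j) pj → ⊥-elim (none j pj) })
  ... | inj₂ (i , pi , min) | no ¬p0 = inj₂ (Fin.suc i , pi , λ { Fin.zero p0 → ⊥-elim (¬p0 p0) ; (Fin.suc j) pj → min j pj })
  ... | inj₂ (i , pi , min) | yes p0 with f Fin.zero ℤ.≤? f (Fin.suc i)
  ...   | yes f0≤fi = inj₂ (Fin.zero , p0 , λ { Fin.zero _ → ℤP.≤-refl ; (Fin.suc j) pj → ℤP.≤-trans f0≤fi (min j pj) })
  ...   | no  f0≰fi = inj₂ (Fin.suc i , pi , λ { Fin.zero _ → ℤP.<⇒≤ (ℤP.≰⇒> f0≰fi) ; (Fin.suc j) pj → min j pj })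

  rearrangement : ∀ {χ ψ v : Point m} t → Binary χ → Binary ψ → sumFinℤ m ψ ≡ sumFinℤ m χ →
    (∀ j → χ j ≡ + 1 → t ≤ v j) → (∀ j → χ j ≡ + 0 → v j ≤ t) → dot ψ v ≤ dot χ v
  rearrangement {m} {χ} {ψ} {v} t χ-bin ψ-bin ∑ψ≡∑χ above below = begin
    dot ψ v                                              ≤⟨ sum-mono-≤ termwise ⟩
    sumFinℤ m (λ j → χ j * v j + t * (ψ j - χ j))        ≡⟨ sum-+ (λ j → χ j * v j) (λ j → t * (ψ j - χ j)) ⟩
    dot χ v + sumFinℤ m (λ j → t * (ψ j - χ j))          ≡⟨ cong (λ s → dot χ v + s) (trans (sum-*ˡ t (λ j → ψ j - χ j)) (cong (t *_) (sum-- ψ χ))) ⟩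
    dot χ v + t * (sumFinℤ m ψ - sumFinℤ m χ)            ≡⟨ cong (λ s → dot χ v + t * (s - sumFinℤ m χ)) ∑ψ≡∑χ ⟩
    dot χ v + t * (sumFinℤ m χ - sumFinℤ m χ)            ≡⟨ vanish (dot χ v) t (sumFinℤ m χ) ⟩
    dot χ v ∎
    where
    open ℤP.≤-Reasoning
    vanish : ∀ d t s → d + t * (s - s) ≡ d
    vanish = solve-∀
    termwise : ∀ j → ψ j * v j ≤ χ j * v j + t * (ψ j - χ j)
    termwise j with χ-bin j | ψ-bin j
    ... | inj₁ χj≡0 | inj₁ ψj≡0 rewrite χj≡0 | ψj≡0 = ℤP.≤-reflexive (e (v j) t)
      where
      e : ∀ x t → + 0 * x ≡ + 0 * x + t * (+ 0 - + 0)
      e = solve-∀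
    ... | inj₂ χj≡1 | inj₂ ψj≡1 rewrite χj≡1 | ψj≡1 = ℤP.≤-reflexive (e (v j) t)
      where
      e : ∀ x t → + 1 * x ≡ + 1 * x + t * (+ 1 - + 1)
      e = solve-∀
    ... | inj₂ χj≡1 | inj₁ ψj≡0 rewrite χj≡1 | ψj≡0 =
      subst₂ _≤_ (e₁ (v j)) (e₂ (v j) t) (ℤP.i≤j⇒0≤j-i (above j χj≡1))
      where
      e₁ : ∀ x → + 0 ≡ + 0 * x
      e₁ = solve-∀
      e₂ : ∀ x t → x - t ≡ + 1 * x + t * (+ 0 - + 1)
      e₂ = solve-∀
    ... | inj₁ χj≡0 | inj₂ ψj≡1 rewrite χj≡0 | ψj≡1 = subst₂ _≤_ (e₁ (v j)) (e₂ (v j) t) (below j χj≡0)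
      where
      e₁ : ∀ x → x ≡ + 1 * x
      e₁ = solve-∀
      e₂ : ∀ x t → t ≡ + 0 * x + t * (+ 1 - + 0)
      e₂ = solve-∀

  +-cancelˡ-≤ : ∀ c {a b} → c + a ≤ c + b → a ≤ b
  +-cancelˡ-≤ c {a} {b} c+a≤c+b = subst₂ _≤_ (drop c a) (drop c b) (ℤP.+-monoʳ-≤ (- c) c+a≤c+b)
    where
    drop : ∀ c x → - c + (c + x) ≡ x
    drop = solve-∀

  +-cancelˡ-< : ∀ c {a b} → c + a < c + b → a < b
  +-cancelˡ-< c {a} {b} c+a<c+b = subst₂ _<_ (drop c a) (drop c b) (ℤP.+-monoʳ-< (- c) c+a<c+b)
    where
    drop : ∀ c x → - c + (c + x) ≡ x
    drop = solve-∀

  affine-cancel-≤ : ∀ h {g} → + 0 < g → ∀ {x y} → h + g * x ≤ h + g * y → x ≤ y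
  affine-cancel-≤ h {g} 0<g {x} {y} le = ℤP.*-cancelˡ-≤-pos x y g {{ℤ.positive 0<g}} (+-cancelˡ-≤ h le)

  affine-cancel-< : ∀ h {g} → + 0 < g → ∀ {x y} → h + g * x < h + g * y → x < y
  affine-cancel-< h {g} 0<g {x} {y} lt = ℤP.*-cancelˡ-<-nonNeg g {{ℤ.nonNegative (ℤP.<⇒≤ 0<g)}} (+-cancelˡ-< h lt)

  affine-mono-≤ : ∀ h {g} → + 0 ≤ g → ∀ {x y} → x ≤ y → h + g * x ≤ h + g * y
  affine-mono-≤ h {g} 0≤g x≤y = ℤP.+-monoʳ-≤ h (ℤP.*-monoˡ-≤-nonNeg g {{ℤ.nonNegative 0≤g}} x≤y)

  affine-antimono-≤ : ∀ h {g} → g ≤ + 0 → ∀ {x y} → x ≤ y → h + g * y ≤ h + g * x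
  affine-antimono-≤ h {g} g≤0 x≤y = ℤP.+-monoʳ-≤ h (ℤP.*-monoˡ-≤-nonPos g {{ℤ.nonPositive g≤0}} x≤y)

  indicator : ∀ {p} {P : Set p} → Dec P → ℤ
  indicator (yes _) = + 1
  indicator (no _)  = + 0

  module _ {p} {P : Set p} where

    indicator-yes : (d : Dec P) → P → indicator d ≡ + 1
    indicator-yes (yes _) _  = refl
    indicator-yes (no ¬p) p  = ⊥-elim (¬p p)

    indicator-no : (d : Dec P) → ¬ P → indicator d ≡ + 0
    indicator-no (yes p) ¬p = ⊥-elim (¬p p)
    indicator-no (no _)  _  = refl

    indicator-nonneg : (d : Dec P) → + 0 ≤ indicator d
    indicator-nonneg (yes _) = ℤ.+≤+ ℕ.z≤n
    indicator-nonneg (no _)  = ℤP.≤-refl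

    indicator-one : (d : Dec P) → indicator d ≡ + 1 → P
    indicator-one (yes p) _ = p

    indicator-zero : (d : Dec P) → indicator d ≡ + 0 → ¬ P
    indicator-zero (no ¬p) _ = ¬p

  indicator-binary : ∀ {p} {P : Fin m → Set p} (P? : ∀ i → Dec (P i)) → Binary (λ i → indicator (P? i))
  indicator-binary P? i with P? i
  ... | yes _ = inj₂ refl
  ... | no _  = inj₁ refl

  complement : Point m → Point m
  complement χ i = + 1 - χ i

  complement-binary : {χ : Point m} → Binary χ → Binary (complement χ)
  complement-binary χ-bin i with χ-bin i
  ... | inj₁ χi≡0 rewrite χi≡0 = inj₂ refl
  ... | inj₂ χi≡1 rewrite χi≡1 = inj₁ refl

  complement-one : {χ : Point m} → Binary χ → ∀ {l} → complement χ l ≡ + 1 → χ l ≡ + 0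
  complement-one χ-bin {l} χ̅l≡1 = binary-≢1 χ-bin l λ χl≡1 → case (trans (sym (cong (λ z → + 1 - z) χl≡1)) χ̅l≡1)
    where
    case : + 1 - + 1 ≢ + 1
    case ()

  sum-complement : (χ : Point m) → sumFinℤ m (complement χ) ≡ + m - sumFinℤ m χ
  sum-complement {m} χ = trans (sum-- (λ _ → + 1) χ) (cong (_- sumFinℤ m χ) (trans (sum-const m (+ 1)) (ℤP.*-identityʳ (+ m))))

  dot-complement : (χ w : Point m) → dot (complement χ) w ≡ sumFinℤ m w - dot χ w
  dot-complement χ w = trans (sum-cong (λ l → distrib (χ l) (w l))) (sum-- w (λ l → χ l * w l))
    where
    distrib : ∀ c x → (+ 1 - c) * x ≡ x - c * x
    distrib = solve-∀

  module _ {χ : Point m} (χ-bin : Binary χ) (i : Fin m) where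

    drop-one-binary : χ i ≡ + 1 → Binary (λ l → χ l - δ i l)
    drop-one-binary χi≡1 l with l FinP.≟ i
    ... | yes refl rewrite χi≡1 | δ-diag l = inj₁ refl
    ... | no  l≢i rewrite δ-off i l (l≢i ∘ sym) | ℤP.+-identityʳ (χ l) = χ-bin l

    drop-one-ones : ∀ {l} → χ l - δ i l ≡ + 1 → l ≢ i × χ l ≡ + 1
    drop-one-ones {l} ≡1 with l FinP.≟ i
    ... | no  l≢i = l≢i , trans (sym (ℤP.+-identityʳ (χ l))) (subst (λ z → χ l - z ≡ + 1) (δ-off i l (l≢i ∘ sym)) ≡1)
    ... | yes refl with χ-bin l
    ...   | inj₁ χl≡0 = ⊥-elim (case (trans (sym (cong₂ _-_ χl≡0 (δ-diag l))) ≡1))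
      where
      case : + 0 - + 1 ≢ + 1
      case ()
    ...   | inj₂ χl≡1 = ⊥-elim (case (trans (sym (cong₂ _-_ χl≡1 (δ-diag l))) ≡1))
      where
      case : + 1 - + 1 ≢ + 1
      case ()

    add-one-binary : χ i ≡ + 0 → Binary (λ l → χ l + δ i l)
    add-one-binary χi≡0 l with l FinP.≟ i
    ... | yes refl rewrite χi≡0 | δ-diag l = inj₂ refl
    ... | no  l≢i rewrite δ-off i l (l≢i ∘ sym) | ℤP.+-identityʳ (χ l) = χ-bin l

    add-one-zeros : ∀ {l} → χ l + δ i l ≡ + 0 → l ≢ i × χ l ≡ + 0
    add-one-zeros {l} ≡0 with l FinP.≟ i
    ... | no  l≢i = l≢i , trans (sym (ℤP.+-identityʳ (χ l))) (subst (λ z → χ l + z ≡ + 0) (δ-off i l (l≢i ∘ sym)) ≡0)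
    ... | yes refl with χ-bin l
    ...   | inj₁ χl≡0 = ⊥-elim (case (trans (sym (cong₂ _+_ χl≡0 (δ-diag l))) ≡0))
      where
      case : + 0 + + 1 ≢ + 0
      case ()
    ...   | inj₂ χl≡1 = ⊥-elim (case (trans (sym (cong₂ _+_ χl≡1 (δ-diag l))) ≡0))
      where
      case : + 1 + + 1 ≢ + 0
      case ()

  module _ {a} {A : Set a} {x t : ℕ} (y z : A) where

    if-<ᵇ-< : x ℕ.< t → (if x <ᵇ t then y else z) ≡ y
    if-<ᵇ-< x<t with x <ᵇ t | ℕP.<⇒<ᵇ x<t
    ... | true | _ = refl

    if-<ᵇ-≥ : t ℕ.≤ x → (if x <ᵇ t then y else z) ≡ z
    if-<ᵇ-≥ t≤x with x <ᵇ t in eq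
    ... | true  = ⊥-elim (ℕP.<⇒≱ (ℕP.<ᵇ⇒< x t (subst T (sym eq) tt)) t≤x)
    ... | false = refl

    if-≡ᵇ-≡ : x ≡ t → (if x ≡ᵇ t then y else z) ≡ y
    if-≡ᵇ-≡ x≡t with x ≡ᵇ t | ℕP.≡⇒≡ᵇ x t x≡t
    ... | true | _ = refl

    if-≡ᵇ-≢ : x ≢ t → (if x ≡ᵇ t then y else z) ≡ z
    if-≡ᵇ-≢ x≢t with x ≡ᵇ t in eq
    ... | true  = ⊥-elim (x≢t (ℕP.≡ᵇ⇒≡ x t (subst T (sym eq) tt)))
    ... | false = refl

  prefix : ℕ → Point m
  prefix t i = if toℕ i <ᵇ t then + 1 else + 0

  prefix-< : ∀ t (i : Fin m) → toℕ i ℕ.< t → prefix t i ≡ + 1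
  prefix-< t i = if-<ᵇ-< (+ 1) (+ 0)

  prefix-≥ : ∀ t (i : Fin m) → t ℕ.≤ toℕ i → prefix t i ≡ + 0
  prefix-≥ t i = if-<ᵇ-≥ (+ 1) (+ 0)

  prefix-binary : ∀ t → Binary (prefix {m} t)
  prefix-binary t i with toℕ i <ᵇ t
  ... | true  = inj₂ refl
  ... | false = inj₁ refl

  prefix-one : ∀ t (i : Fin m) → prefix t i ≡ + 1 → toℕ i ℕ.< t
  prefix-one t i ≡1 with toℕ i ℕ.<? t
  ... | yes i<t = i<t
  ... | no  i≮t = ⊥-elim (case (trans (sym (prefix-≥ t i (ℕP.≮⇒≥ i≮t))) ≡1))
    where
    case : + 0 ≢ + 1
    case ()

  prefix-zero : ∀ t (i : Fin m) → prefix t i ≡ + 0 → t ℕ.≤ toℕ i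
  prefix-zero t i ≡0 with toℕ i ℕ.<? t
  ... | no  i≮t = ℕP.≮⇒≥ i≮t
  ... | yes i<t = ⊥-elim (case (trans (sym (prefix-< t i i<t)) ≡0))
    where
    case : + 1 ≢ + 0
    case ()

  prefix-*-prefix : ∀ {s t} → s ℕ.≤ t → (i : Fin m) → prefix s i * prefix t i ≡ prefix s i
  prefix-*-prefix {s = s} {t} s≤t i with toℕ i ℕ.<? s
  ... | yes i<s rewrite prefix-< s i i<s | prefix-< t i (ℕP.<-≤-trans i<s s≤t) = refl
  ... | no  i≮s rewrite prefix-≥ s i (ℕP.≮⇒≥ i≮s) = refl

  sum-prefix : ∀ m t → t ℕ.≤ m → sumFinℤ m (prefix t) ≡ + t
  sum-prefix zero    zero    _           = refl
  sum-prefix (suc m) zero    _           = sum-zero (prefix {suc m} zero) (λ i → prefix-≥ zero i ℕ.z≤n)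
  sum-prefix (suc m) (suc t) (ℕ.s≤s t≤m) = cong (λ s → + 1 + s) (sum-prefix m t t≤m)

  dot-prefix-last : ∀ m (q : Fin (suc m) → ℤ) → dot (prefix m) q ≡ sumFinℤ (suc m) q - q (Fin.fromℕ m)
  dot-prefix-last zero    q = vanish (q Fin.zero)
    where
    vanish : ∀ x → + 0 * x + + 0 ≡ x + + 0 - x
    vanish = solve-∀
  dot-prefix-last (suc m) q = trans (cong (λ s → + 1 * q Fin.zero + s) (dot-prefix-last m (q ∘ Fin.suc)))
                                    (reassoc (q Fin.zero) (sumFinℤ (suc m) (q ∘ Fin.suc)) (q (Fin.fromℕ (suc m))))
    where
    reassoc : ∀ a s z → + 1 * a + (s - z) ≡ a + s - z
    reassoc = solve-∀

  dot-prefix-one : ∀ m (q : Fin (suc m) → ℤ) → dot (prefix 1) q ≡ q Fin.zero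
  dot-prefix-one m q = trans (cong (λ s → + 1 * q Fin.zero + s) (sum-zero (λ i → + 0 * q (Fin.suc i)) (λ _ → refl)))
                             (unit (q Fin.zero))
    where
    unit : ∀ x → + 1 * x + + 0 ≡ x
    unit = solve-∀

  threshold : ∀ {μ : Fin m → ℕ} → IsPartition μ → ∀ θ →
    ∃ λ T → T ℕ.≤ m × (∀ i → θ ℕ.≤ μ i → toℕ i ℕ.< T) × (∀ i → toℕ i ℕ.< T → θ ℕ.≤ μ i)
  threshold {zero}  μ-dec θ = 0 , ℕ.z≤n , (λ ()) , (λ ())
  threshold {suc m} {μ} μ-dec θ with θ ℕ.≤? μ Fin.zero
  ... | no  θ≰μ0 = 0 , ℕ.z≤n , (λ i θ≤μi → ⊥-elim (θ≰μ0 (ℕP.≤-trans θ≤μi (μ-dec Fin.zero i ℕ.z≤n)))) , (λ i ())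
  ... | yes θ≤μ0 with threshold {μ = μ ∘ Fin.suc} (λ i j i≤j → μ-dec (Fin.suc i) (Fin.suc j) (ℕ.s≤s i≤j)) θ
  ...   | T , T≤m , below , above = suc T , ℕ.s≤s T≤m , below′ , above′
    where
    below′ : ∀ i → θ ℕ.≤ μ i → toℕ i ℕ.< suc T
    below′ Fin.zero    _     = ℕ.s≤s ℕ.z≤n
    below′ (Fin.suc i) θ≤μi = ℕ.s≤s (below i θ≤μi)
    above′ : ∀ i → toℕ i ℕ.< suc T → θ ℕ.≤ μ i
    above′ Fin.zero    _           = θ≤μ0
    above′ (Fin.suc i) (ℕ.s≤s i<T) = above i i<T

  +-self≡*2 : ∀ t → t ℕ.+ t ≡ t ℕ.* 2
  +-self≡*2 t = trans (cong (t ℕ.+_) (sym (ℕP.+-identityʳ t))) (ℕP.*-comm 2 t)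

  halve-even : ∀ {m t} → m ≡ t ℕ.+ t → m % 2 ≡ 0 × m / 2 ≡ t
  halve-even {t = t} refl rewrite +-self≡*2 t = m*n%n≡0 t 2 , m*n/n≡m t 2

  halve-odd : ∀ {m t} → m ≡ suc (t ℕ.+ t) → m % 2 ≡ 1 × m / 2 ≡ t
  halve-odd {t = t} refl rewrite +-self≡*2 t =
    [m+kn]%n≡m%n 1 t 2 , trans (+-distrib-/ 1 (t ℕ.* 2) (subst (λ r → 1 ℕ.+ r ℕ.< 2) (sym (m*n%n≡0 t 2)) ℕP.≤-refl))
                               (m*n/n≡m t 2)

  halves-even : ∀ m → m % 2 ≡ 0 → m ≡ m / 2 ℕ.+ m / 2
  halves-even m m%2≡0 = trans (m≡m%n+[m/n]*n m 2) (trans (cong (ℕ._+ m / 2 ℕ.* 2) m%2≡0) (sym (+-self≡*2 (m / 2))))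

  halves-odd : ∀ m → m % 2 ≡ 1 → m ≡ suc (m / 2 ℕ.+ m / 2)
  halves-odd m m%2≡1 = trans (m≡m%n+[m/n]*n m 2) (trans (cong (ℕ._+ m / 2 ℕ.* 2) m%2≡1) (cong suc (sym (+-self≡*2 (m / 2)))))

  asPoint : (Fin m → ℕ) → Point m
  asPoint lam i = + lam i

  Face⊆ : PointSet m → Point m → Point m → Set
  Face⊆ S c a = ∀ w → OnFace S c w → OnFace S a w

  module _ {m : ℕ} (lam : Fin m → ℕ) where

    private
      S = Orbit lam
      N = sumFinℤ m (asPoint lam)

    orbit-self : S (asPoint lam)
    orbit-self = Perm.id , λ _ → refl

    orbit-permute : ∀ {v} → S v → (π : Permutation′ m) → S (λ i → v (π ⟨$⟩ʳ i))
    orbit-permute (σ , v≡) π = π Perm.∘ₚ σ , λ i → v≡ (π ⟨$⟩ʳ i)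

    orbit-sum-map : ∀ {v} → S v → (g : ℤ → ℤ) → sumFinℤ m (g ∘ v) ≡ sumFinℤ m (g ∘ asPoint lam)
    orbit-sum-map (σ , v≡) g = trans (sum-cong (λ i → cong g (v≡ i))) (sum-permute (g ∘ asPoint lam) σ)

    orbit-sum : ∀ {v} → S v → sumFinℤ m v ≡ N
    orbit-sum Sv = orbit-sum-map Sv (λ z → z)

    orbit-related : ∀ {v w} → S v → S w → ∃ λ (π : Permutation′ m) → ∀ i → w i ≡ v (π ⟨$⟩ʳ i)
    orbit-related (σ , v≡) (ρ , w≡) = ρ Perm.∘ₚ Perm.flip σ , λ i →
      trans (w≡ i) (sym (trans (v≡ _) (cong (λ z → + lam z) (Perm.inverseʳ σ))))

    orbit-attains : ∀ {v} → S v → ∀ j → ∃ λ l → v l ≡ + lam j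
    orbit-attains (σ , v≡) j = σ ⟨$⟩ˡ j , trans (v≡ _) (cong (λ z → + lam z) (Perm.inverseʳ σ))

    dot-orbit-affine : ∀ {a χ : Point m} h g → (∀ l → a l ≡ h + g * χ l) →
      ∀ {w} → S w → dot a w ≡ h * N + g * dot χ w
    dot-orbit-affine {a} {χ} h g a≡ {w} Sw = trans (dot-affine h g a≡ w) (cong (λ s → h * s + g * dot χ w) (orbit-sum Sw))

    maximiser-transpose : ∀ {a v} → MaxAt S a v → ∀ i j → (a i - a j) * (v j - v i) ≤ + 0
    maximiser-transpose {a} {v} (Sv , max) i j = ℤP.≤-trans X≤dv-dv (ℤP.≤-reflexive (ℤP.+-inverseʳ (dot a v)))
      where
      X = (a i - a j) * (v j - v i)
      dv+X≤dv : dot a v + X ≤ dot a v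
      dv+X≤dv = subst (_≤ dot a v) (dot-transpose i j a v) (max _ (orbit-permute Sv (Perm.transpose i j)))
      X≤dv-dv : X ≤ dot a v - dot a v
      X≤dv-dv = subst (_≤ dot a v - dot a v) (cancel (dot a v) X) (ℤP.+-monoˡ-≤ (- dot a v) dv+X≤dv)
        where
        cancel : ∀ d x → d + x - d ≡ x
        cancel = solve-∀

    maximiser-sorted : ∀ {a v} → MaxAt S a v → ∀ {i j} → a j < a i → v j ≤ v i
    maximiser-sorted {a} {v} max {i} {j} aj<ai with v j ℤ.≤? v i
    ... | yes vj≤vi = vj≤vi
    ... | no  vj≰vi = ⊥-elim (ℤP.<-irrefl refl (ℤP.<-≤-trans 0<X (maximiser-transpose {a} max i j)))
      where
      0<X : + 0 < (a i - a j) * (v j - v i)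
      0<X = 0<-* (0<-diff aj<ai) (0<-diff (ℤP.≰⇒> vj≰vi))

    sorted⇒maximiser : ∀ {χ v} → Binary χ → S v → (∀ i j → χ i ≡ + 1 → χ j ≡ + 0 → v j ≤ v i) → MaxAt S χ v
    sorted⇒maximiser {χ} {v} χ-bin Sv sorted with argmin-where (λ i → χ i ℤ.≟ + 1) v
    ... | inj₁ no-one = Sv , λ w _ → ℤP.≤-reflexive (trans (vanishes w) (sym (vanishes v)))
      where
      vanishes : ∀ w → dot χ w ≡ + 0
      vanishes w = sum-zero (λ l → χ l * w l) (λ l → cong (_* w l) (binary-≢1 χ-bin l (no-one l)))
    ... | inj₂ (i , χi≡1 , min) = Sv , λ w Sw → maximal w (orbit-related Sv Sw)
      where
      maximal : ∀ w → (∃ λ π → ∀ l → w l ≡ v (π ⟨$⟩ʳ l)) → dot χ w ≤ dot χ v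
      maximal w (π , w≡) = subst (_≤ dot χ v) (sym dot-χ-w)
        (rearrangement (v i) χ-bin (λ j → χ-bin _) ∑ψ≡∑χ min (λ j χj≡0 → sorted i j χi≡1 χj≡0))
        where
        ψ : Point m
        ψ j = χ (π ⟨$⟩ˡ j)
        dot-χ-w : dot χ w ≡ dot ψ v
        dot-χ-w = trans (sum-cong (λ l → cong₂ _*_ (cong χ (sym (Perm.inverseˡ π))) (w≡ l)))
                        (sum-permute (λ j → ψ j * v j) π)
        ∑ψ≡∑χ : sumFinℤ m ψ ≡ sumFinℤ m χ
        ∑ψ≡∑χ = trans (sym (sum-permute ψ π)) (sum-cong (λ l → cong χ (Perm.inverseˡ π {l})))

    -- swapping two coordinates of equal c-weight stays on the face of c, so a must weigh them equally
    face⊆-level : ∀ {c a v} → OnFace S c v → Face⊆ S c a → ∀ l j → c l ≡ c j → v j ≢ v l → a l ≡ a j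
    face⊆-level {c} {a} {v} c-v@(Sv , max) c⊆a l j cl≡cj vj≢vl = ℤP.i-j≡0⇒i≡j (a l) (a j) al-aj≡0
      where
      u : Point m
      u i = v (Perm.transpose l j ⟨$⟩ʳ i)
      Su : S u
      Su = orbit-permute Sv (Perm.transpose l j)
      c-u : OnFace S c u
      c-u = Su , λ w Sw → subst (dot c w ≤_) (sym (dot-transpose-level c v l j cl≡cj)) (max w Sw)
      au≡av : dot a u ≡ dot a v
      au≡av = ℤP.≤-antisym (proj₂ (c⊆a v c-v) u Su) (proj₂ (c⊆a u c-u) v Sv)
      X≡0 : (a l - a j) * (v j - v l) ≡ + 0
      X≡0 = begin
        X                      ≡⟨ shift (dot a v) X ⟩
        dot a v + X - dot a v  ≡⟨ cong (_- dot a v) (trans (sym (dot-transpose l j a v)) au≡av) ⟩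
        dot a v - dot a v      ≡⟨ ℤP.+-inverseʳ (dot a v) ⟩
        + 0 ∎
        where
        open ≡-Reasoning
        X = (a l - a j) * (v j - v l)
        shift : ∀ d x → x ≡ d + x - d
        shift = solve-∀
      al-aj≡0 : a l - a j ≡ + 0
      al-aj≡0 with ℤP.i*j≡0⇒i≡0∨j≡0 (a l - a j) X≡0
      ... | inj₁ ≡0 = ≡0
      ... | inj₂ ≡0 = ⊥-elim (vj≢vl (ℤP.i-j≡0⇒i≡j (v j) (v l) ≡0))

    face⊆-binary : ∀ {a χ} → Binary χ → (∀ i j → χ i ≡ + 1 → χ j ≡ + 0 → a j < a i) → Face⊆ S a χ
    face⊆-binary χ-bin separates w a-w@(Sw , _) =
      sorted⇒maximiser χ-bin Sw (λ i j χi≡1 χj≡0 → maximiser-sorted a-w (separates i j χi≡1 χj≡0))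

    module _ {a χ : Point m} (h g : ℤ) (a≡ : ∀ l → a l ≡ h + g * χ l) (0<g : + 0 < g) where

      private
        dot-a : ∀ {w} → S w → dot a w ≡ h * N + g * dot χ w
        dot-a = dot-orbit-affine h g a≡

      affine-face⊆ : Face⊆ S a χ
      affine-face⊆ w (Sw , max) = Sw , λ w′ Sw′ →
        affine-cancel-≤ (h * N) 0<g (subst₂ _≤_ (dot-a Sw′) (dot-a Sw) (max w′ Sw′))

      affine-face⊇ : Face⊆ S χ a
      affine-face⊇ w (Sw , max) = Sw , λ w′ Sw′ →
        subst₂ _≤_ (sym (dot-a Sw′)) (sym (dot-a Sw)) (affine-mono-≤ (h * N) (ℤP.<⇒≤ 0<g) (max w′ Sw′))

      affine-proper : ProperFace S a → ProperFace S χ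
      affine-proper (w₁ , w₂ , Sw₁ , Sw₂ , lt) =
        w₁ , w₂ , Sw₁ , Sw₂ , affine-cancel-< (h * N) 0<g (subst₂ _<_ (dot-a Sw₁) (dot-a Sw₂) lt)

      affine-facet : Facet S a → Facet S χ
      affine-facet (proper , maximal) = affine-proper proper , λ b b-proper χ⊆b w b-w →
        affine-face⊆ w (maximal b b-proper (λ w′ → χ⊆b w′ ∘ affine-face⊆ w′) w b-w)

  Spread : ∀ {m} → Point m → ℤ → Point m → Fin m → Set
  Spread χ c w₀ x = (∀ i → χ i ≡ c → i ≡ x) ⊎ (∃ λ y → χ y ≡ c × w₀ x ≢ w₀ y)

  spread-constant : ∀ {m} {b χ w₀ : Point m} {c x} → χ x ≡ c → Spread χ c w₀ x →
    (∀ l j → χ l ≡ χ j → w₀ j ≢ w₀ l → b l ≡ b j) → ∀ i → χ i ≡ c → b i ≡ b x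
  spread-constant χx≡c (inj₁ singleton) _ i χi≡c = cong _ (singleton i χi≡c)
  spread-constant {w₀ = w₀} {x = x} χx≡c (inj₂ (y , χy≡c , w₀x≢w₀y)) b-level i χi≡c with w₀ i ℤ.≟ w₀ x
  ... | no  w₀i≢w₀x = b-level i x (trans χi≡c (sym χx≡c)) (w₀i≢w₀x ∘ sym)
  ... | yes w₀i≡w₀x = trans (b-level i y (trans χi≡c (sym χy≡c)) (λ e → w₀x≢w₀y (trans (sym w₀i≡w₀x) (sym e))))
                            (sym (b-level x y (trans χx≡c (sym χy≡c)) (w₀x≢w₀y ∘ sym)))

  module Facets {n-1 : ℕ} (lam : Fin (suc n-1) → ℕ) (gap : lam (Fin.fromℕ n-1) ℕ.< lam Fin.zero) where

    n : ℕ
    n = suc n-1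

    S : PointSet n
    S = Orbit lam

    last : Fin n
    last = Fin.fromℕ n-1

    top bottom N : ℤ
    top    = + lam Fin.zero
    bottom = + lam last
    N      = sumFinℤ n (asPoint lam)

    bottom<top : bottom < top
    bottom<top = ℤ.+<+ gap

    zero≢last : Fin.zero ≢ last
    zero≢last 0≡last = ℕP.<-irrefl (cong lam (sym 0≡last)) gap

    orbit-nonconstant : ∀ {v} → S v → ∀ j → ¬ (∀ l → v l ≡ v j)
    orbit-nonconstant Sv j constant with orbit-attains lam Sv Fin.zero | orbit-attains lam Sv last
    ... | l , vl≡top | l′ , vl′≡bottom =
      ℤP.<-irrefl (trans (sym vl′≡bottom) (trans (constant l′) (trans (sym (constant l)) vl≡top))) bottom<top

    two-point : ∀ {i j} → i ≢ j → ∃ λ u → S u × u i ≡ top × u j ≡ bottom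
    two-point {i} {j} i≢j = (λ l → + lam (σ ⟨$⟩ʳ l)) , (σ , λ _ → refl) , ui≡top , uj≡bottom
      where
      j′ = Perm.transpose i Fin.zero ⟨$⟩ʳ j
      σ : Permutation′ n
      σ = Perm.transpose i Fin.zero Perm.∘ₚ Perm.transpose j′ last
      j′≢0 : j′ ≢ Fin.zero
      j′≢0 j′≡0 = i≢j (begin
        i                                          ≡⟨ sym (transpose-matchˡ Fin.zero i) ⟩
        Perm.transpose i Fin.zero ⟨$⟩ˡ Fin.zero    ≡⟨ cong (Perm.transpose i Fin.zero ⟨$⟩ˡ_) (sym j′≡0) ⟩
        Perm.transpose i Fin.zero ⟨$⟩ˡ j′          ≡⟨ Perm.inverseˡ (Perm.transpose i Fin.zero) ⟩
        j ∎)
        where open ≡-Reasoning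
      ui≡top : + lam (σ ⟨$⟩ʳ i) ≡ top
      ui≡top = trans (cong (λ z → + lam (Perm.transpose j′ last ⟨$⟩ʳ z)) (transpose-matchˡ i Fin.zero))
                     (cong (λ z → + lam z) (transpose-other j′ last (j′≢0 ∘ sym) zero≢last))
      uj≡bottom : + lam (σ ⟨$⟩ʳ j) ≡ bottom
      uj≡bottom = cong (λ z → + lam z) (transpose-matchˡ j′ last)

    proper-face : ∀ {c i j} → c j < c i → ProperFace S c
    proper-face {c} {i} {j} cj<ci with two-point {i} {j} (λ i≡j → ℤP.<-irrefl (cong c (sym i≡j)) cj<ci)
    ... | u , Su , ui≡top , uj≡bottom =
      (λ l → u (Perm.transpose i j ⟨$⟩ʳ l)) , u , orbit-permute lam Su (Perm.transpose i j) , Su , 0<-diff⁻¹ gain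
      where
      gain : + 0 < dot c u - dot c (λ l → u (Perm.transpose i j ⟨$⟩ʳ l))
      gain = subst (+ 0 <_) (begin
        (c i - c j) * (top - bottom)                         ≡⟨ cong₂ (λ x y → (c i - c j) * (x - y)) (sym ui≡top) (sym uj≡bottom) ⟩
        (c i - c j) * (u i - u j)                            ≡⟨ undo (dot c u) (c i - c j) (u i) (u j) ⟩
        dot c u - (dot c u + (c i - c j) * (u j - u i))      ≡⟨ cong (λ s → dot c u - s) (sym (dot-transpose i j c u)) ⟩
        dot c u - dot c (λ l → u (Perm.transpose i j ⟨$⟩ʳ l)) ∎)
        (0<-* (0<-diff cj<ci) (0<-diff bottom<top))
        where
        open ≡-Reasoning
        undo : ∀ d x y z → x * (y - z) ≡ d - (d + x * (z - y))
        undo = solve-∀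

    binary-facet : ∀ {χ w₀ i j} → Binary χ → MaxAt S χ w₀ → χ i ≡ + 1 → χ j ≡ + 0 →
      Spread χ (+ 1) w₀ i → Spread χ (+ 0) w₀ j → Facet S χ
    binary-facet {χ} {w₀} {i} {j} χ-bin χ-w₀@(Sw₀ , max) χi≡1 χj≡0 spread₁ spread₀ =
      proper-face {χ} (subst₂ _<_ (sym χj≡0) (sym χi≡1) (ℤ.+<+ (ℕ.s≤s ℕ.z≤n))) , maximal
      where
      maximal : ∀ b → ProperFace S b → Face⊆ S χ b → Face⊆ S b χ
      maximal b (w₁ , w₂ , Sw₁ , Sw₂ , w₁<w₂) χ⊆b = affine-face⊆ lam (b j) g b≡ 0<g
        where
        g = b i - b j
        constant-on : ∀ {c x} → χ x ≡ c → Spread χ c w₀ x → ∀ l → χ l ≡ c → b l ≡ b x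
        constant-on χx≡c spread = spread-constant χx≡c spread (face⊆-level lam {χ} {b} χ-w₀ χ⊆b)
        b≡ : ∀ l → b l ≡ b j + g * χ l
        b≡ l with χ-bin l
        ... | inj₁ χl≡0 rewrite χl≡0 = trans (constant-on χj≡0 spread₀ l χl≡0) (at-0 (b j) g)
          where
          at-0 : ∀ x g → x ≡ x + g * + 0
          at-0 = solve-∀
        ... | inj₂ χl≡1 rewrite χl≡1 = trans (constant-on χi≡1 spread₁ l χl≡1) (at-1 (b i) (b j))
          where
          at-1 : ∀ x y → x ≡ y + (x - y) * + 1
          at-1 = solve-∀
        dot-b : ∀ {w} → S w → dot b w ≡ b j * N + g * dot χ w
        dot-b = dot-orbit-affine lam (b j) g b≡
        0<g : + 0 < g
        0<g with + 0 ℤ.<? g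
        ... | yes 0<g = 0<g
        ... | no  0≮g = ⊥-elim (ℤP.<-irrefl refl (ℤP.<-≤-trans w₁<w₂ (ℤP.≤-trans w₂≤w₀ w₀≤w₁)))
          where
          w₂≤w₀ : dot b w₂ ≤ dot b w₀
          w₂≤w₀ = proj₂ (χ⊆b w₀ χ-w₀) w₂ Sw₂
          w₀≤w₁ : dot b w₀ ≤ dot b w₁
          w₀≤w₁ = subst₂ _≤_ (sym (dot-b Sw₀)) (sym (dot-b Sw₁)) (affine-antimono-≤ (b j * N) (ℤP.≮⇒≥ 0≮g) (max w₁ Sw₁))

    -- the indicators of the top and of the non-bottom values of a facet normal a are normals of the same facet;
    -- a value strictly in between would force every maximiser of a to be constant
    facet-two-valued : ∀ {a v} → Facet S a → MaxAt S a v →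
      ∃ λ χ → Binary χ × Σ ℤ λ h → Σ ℤ λ g → + 0 < g × (∀ l → a l ≡ h + g * χ l)
    facet-two-valued {a} {v} (a-proper , a-maximal) a-v@(Sv , _) with argmax a | argmin a
    ... | iM , ≤M | iL , L≤ with a iM ℤ.≟ a iL
    ...   | yes M≡L = ⊥-elim (not-proper a-proper)
      where
      a≡ : ∀ l → a l ≡ a iM + + 0 * a l
      a≡ l = trans (ℤP.≤-antisym (≤M l) (subst (_≤ a l) (sym M≡L) (L≤ l))) (sym (ℤP.+-identityʳ (a iM)))
      not-proper : ¬ ProperFace S a
      not-proper (w₁ , w₂ , Sw₁ , Sw₂ , lt) = ℤP.<-irrefl (trans (dot-a Sw₁) (sym (dot-a Sw₂))) lt
        where
        dot-a : ∀ {w} → S w → dot a w ≡ a iM * N + + 0 * dot a w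
        dot-a = dot-orbit-affine lam {a} {a} (a iM) (+ 0) a≡
    ...   | no  M≢L = χ , χ-bin , L , M - L , 0<-diff L<M , a≡
      where
      M = a iM
      L = a iL
      L<M : L < M
      L<M = ℤP.≤∧≢⇒< (≤M iL) (M≢L ∘ sym)
      χ ψ : Point n
      χ l = indicator (a l ℤ.≟ M)
      ψ l = indicator (¬? (a l ℤ.≟ L))
      χ-bin : Binary χ
      χ-bin = indicator-binary (λ l → a l ℤ.≟ M)
      ψ-bin : Binary ψ
      ψ-bin = indicator-binary (λ l → ¬? (a l ℤ.≟ L))
      a⊆χ : Face⊆ S a χ
      a⊆χ = face⊆-binary lam χ-bin λ i j χi≡1 χj≡0 →
        subst (a j <_) (sym (indicator-one (a i ℤ.≟ M) χi≡1)) (ℤP.≤∧≢⇒< (≤M j) (indicator-zero (a j ℤ.≟ M) χj≡0))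
      a⊆ψ : Face⊆ S a ψ
      a⊆ψ = face⊆-binary lam ψ-bin λ i j ψi≡1 ψj≡0 →
        subst (_< a i) (sym (decidable-stable (a j ℤ.≟ L) (indicator-zero (¬? (a j ℤ.≟ L)) ψj≡0)))
          (ℤP.≤∧≢⇒< (L≤ i) (indicator-one (¬? (a i ℤ.≟ L)) ψi≡1 ∘ sym))
      χ⊆a : Face⊆ S χ a
      χ⊆a = a-maximal χ (proper-face {χ} {iM} {iL} (subst₂ _<_ (sym (indicator-no (a iL ℤ.≟ M) (M≢L ∘ sym)))
                                                             (sym (indicator-yes (a iM ℤ.≟ M) refl)) (ℤ.+<+ (ℕ.s≤s ℕ.z≤n)))) a⊆χ
      ψ⊆a : Face⊆ S ψ a
      ψ⊆a = a-maximal ψ (proper-face {ψ} {iM} {iL} (subst₂ _<_ (sym (indicator-no (¬? (a iL ℤ.≟ L)) (λ ¬L≡L → ¬L≡L refl)))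
                                                             (sym (indicator-yes (¬? (a iM ℤ.≟ L)) M≢L)) (ℤ.+<+ (ℕ.s≤s ℕ.z≤n)))) a⊆ψ
      swap-equal : ∀ {c} → Face⊆ S a c → Face⊆ S c a → ∀ l j → c l ≡ c j → a l ≢ a j → v l ≡ v j
      swap-equal {c} a⊆c c⊆a l j cl≡cj al≢aj with v j ℤ.≟ v l
      ... | yes vj≡vl = sym vj≡vl
      ... | no  vj≢vl = ⊥-elim (al≢aj (face⊆-level lam {c} {a} (a⊆c v a-v) c⊆a l j cl≡cj vj≢vl))
      module _ {j} (aj≢M : a j ≢ M) (aj≢L : a j ≢ L) where
        top-like : ∀ l → a l ≡ M → v l ≡ v j
        top-like l al≡M = swap-equal a⊆ψ ψ⊆a l j
          (trans (indicator-yes (¬? (a l ℤ.≟ L)) (λ al≡L → M≢L (trans (sym al≡M) al≡L)))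
                 (sym (indicator-yes (¬? (a j ℤ.≟ L)) aj≢L)))
          (λ al≡aj → aj≢M (trans (sym al≡aj) al≡M))
        bottom-like : ∀ l → a l ≡ L → v l ≡ v j
        bottom-like l al≡L = swap-equal a⊆χ χ⊆a l j
          (trans (indicator-no (a l ℤ.≟ M) (λ al≡M → M≢L (trans (sym al≡M) al≡L))) (sym (indicator-no (a j ℤ.≟ M) aj≢M)))
          (λ al≡aj → aj≢L (trans (sym al≡aj) al≡L))
      top-or-bottom : ∀ j → a j ≡ M ⊎ a j ≡ L
      top-or-bottom j with a j ℤ.≟ M | a j ℤ.≟ L
      ... | yes aj≡M | _        = inj₁ aj≡M
      ... | no  _    | yes aj≡L = inj₂ aj≡L
      ... | no  aj≢M | no  aj≢L = ⊥-elim (orbit-nonconstant Sv j v-constant)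
        where
        v-constant : ∀ l → v l ≡ v j
        v-constant l with a l ℤ.≟ M | a l ℤ.≟ L
        ... | yes al≡M | _        = top-like aj≢M aj≢L l al≡M
        ... | no  _    | yes al≡L = bottom-like aj≢M aj≢L l al≡L
        ... | no  al≢M | no  al≢L = trans (sym (top-like al≢M al≢L iM refl)) (top-like aj≢M aj≢L iM refl)
      a≡ : ∀ l → a l ≡ L + (M - L) * χ l
      a≡ l with top-or-bottom l
      ... | inj₁ al≡M rewrite indicator-yes (a l ℤ.≟ M) al≡M = trans al≡M (at-1 M L)
        where
        at-1 : ∀ x y → x ≡ y + (x - y) * + 1
        at-1 = solve-∀
      ... | inj₂ al≡L rewrite indicator-no (a l ℤ.≟ M) (λ al≡M → M≢L (trans (sym al≡M) al≡L)) = trans al≡L (at-0 M L)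
        where
        at-0 : ∀ x y → y ≡ y + (x - y) * + 0
        at-0 = solve-∀

  module _ {m : ℕ} (lam : Fin m → ℕ) where

    private
      N = sumFinℤ m (asPoint lam)

    sum-combo : (fs : Family (Orbit lam)) → sumℚ m (combo fs) ≡ weightSum fs ℚ.* toℚ N
    sum-combo [] = trans (sumℚ-const m 0ℚ) (trans (ℚP.*-zeroʳ (toℚ (+ m))) (sym (ℚP.*-zeroˡ (toℚ N))))
    sum-combo ((q , v , Sv) ∷ fs) = begin
      sumℚ m (λ i → q ℚ.* toℚ (v i) ℚ.+ combo fs i)          ≡⟨ sumℚ-+ (λ i → q ℚ.* toℚ (v i)) (combo fs) ⟩
      sumℚ m (λ i → q ℚ.* toℚ (v i)) ℚ.+ sumℚ m (combo fs)   ≡⟨ cong₂ ℚ._+_ sum-v (sum-combo fs) ⟩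
      q ℚ.* toℚ N ℚ.+ weightSum fs ℚ.* toℚ N                 ≡⟨ sym (ℚP.*-distribʳ-+ (toℚ N) q (weightSum fs)) ⟩
      (q ℚ.+ weightSum fs) ℚ.* toℚ N ∎
      where
      open ≡-Reasoning
      sum-v : sumℚ m (λ i → q ℚ.* toℚ (v i)) ≡ q ℚ.* toℚ N
      sum-v = trans (sumℚ-*ˡ q (λ i → toℚ (v i))) (cong (q ℚ.*_) (trans (sumℚ-toℚ v) (cong toℚ (orbit-sum lam Sv))))

    aff-sum : ∀ {x} → InAff (Orbit lam) x → sumFinℤ m x ≡ N
    aff-sum {x} (fs , ∑w≡1 , combo≡x) = toℚ-injective (begin
      toℚ (sumFinℤ m x)          ≡⟨ sym (sumℚ-toℚ x) ⟩
      sumℚ m (λ i → toℚ (x i))   ≡⟨ sym (sumℚ-cong combo≡x) ⟩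
      sumℚ m (combo fs)          ≡⟨ sum-combo fs ⟩
      weightSum fs ℚ.* toℚ N     ≡⟨ cong (ℚ._* toℚ N) ∑w≡1 ⟩
      1ℚ ℚ.* toℚ N               ≡⟨ ℚP.*-identityˡ _ ⟩
      toℚ N ∎)
      where open ≡-Reasoning

    conv⊆aff : ∀ {x} → InConv (Orbit lam) x → InAff (Orbit lam) x
    conv⊆aff (fs , _ , ∑w≡1 , combo≡x) = fs , ∑w≡1 , combo≡x

  FacetsAtDistanceOne : ∀ {m} → PointSet m → Point m → Set
  FacetsAtDistanceOne S p = ∀ a → Facet S a → ∀ v → MaxAt S a v → ∀ x → InAff S x →
    ¬ ((dot a p < dot a x) × (dot a x < dot a v))

  module _ {n-1 : ℕ} (lam : Fin (suc n-1) → ℕ) (gap : lam (Fin.fromℕ n-1) ℕ.< lam Fin.zero) where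

    open Facets lam gap

    private
      g : ℕ
      g = lam Fin.zero ℕ.∸ suc (lam last)

      width : top - bottom ≡ + suc g
      width = trans (cong (_- bottom) (cong +_ (trans (sym (ℕP.m+[n∸m]≡n gap)) (sym (ℕP.+-suc (lam last) g)))))
                    (cancel bottom (+ suc g))
        where
        cancel : ∀ b x → b + x - b ≡ x
        cancel = solve-∀

      widthℚ : ℚ
      widthℚ = mkℚ (+ suc g) 0 (coprime-1 (suc g))

    -- e_i - e_j = (u - u ∘ (i j)) / (top - bottom) for a vertex u with u i = top and u j = bottom
    root-in-aff : ∀ {p} → InConv S p → ∀ {i j} → i ≢ j → InAff S (λ l → p l + root i j l)
    root-in-aff {p} (fs , _ , ∑w≡1 , combo≡p) {i} {j} i≢j with two-point i≢j
    ... | u , Su , ui≡top , uj≡bottom = fs ++ gs , ∑w≡1′ , combo≡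
      where
      open +-*-Solver
      inv = ℚ.1/ widthℚ
      u′ : Point n
      u′ l = u (Perm.transpose i j ⟨$⟩ʳ l)
      gs : Family S
      gs = (inv , u , Su) ∷ (ℚ.- inv , u′ , orbit-permute lam Su (Perm.transpose i j)) ∷ []
      ∑w≡1′ : weightSum (fs ++ gs) ≡ 1ℚ
      ∑w≡1′ = begin
        weightSum (fs ++ gs)                           ≡⟨ weightSum-++ fs gs ⟩
        weightSum fs ℚ.+ (inv ℚ.+ (ℚ.- inv ℚ.+ 0ℚ))   ≡⟨ cong₂ ℚ._+_ ∑w≡1 (solve 1 (λ x → x :+ (:- x :+ con 0ℚ) := con 0ℚ) refl inv) ⟩
        1ℚ ℚ.+ 0ℚ                                      ≡⟨ ℚP.+-identityʳ 1ℚ ⟩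
        1ℚ ∎
        where open ≡-Reasoning
      u-u′ : ∀ l → u l - u′ l ≡ + suc g * root i j l
      u-u′ l = begin
        u l - u′ l                                      ≡⟨ cong (λ s → u l - s) (transpose-≡-+-root i j u l) ⟩
        u l - (u l + (u j - u i) * root i j l)          ≡⟨ flip (u l) (u i) (u j) (root i j l) ⟩
        (u i - u j) * root i j l                        ≡⟨ cong (_* root i j l) (trans (cong₂ _-_ ui≡top uj≡bottom) width) ⟩
        + suc g * root i j l ∎
        where
        open ≡-Reasoning
        flip : ∀ x y z r → x - (x + (z - y) * r) ≡ (y - z) * r
        flip = solve-∀
      combo≡ : ∀ l → combo (fs ++ gs) l ≡ toℚ (p l + root i j l)
      combo≡ l = begin
        combo (fs ++ gs) l                                                    ≡⟨ combo-++ fs gs l ⟩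
        combo fs l ℚ.+ (inv ℚ.* toℚ (u l) ℚ.+ (ℚ.- inv ℚ.* toℚ (u′ l) ℚ.+ 0ℚ))
          ≡⟨ cong (ℚ._+ (inv ℚ.* toℚ (u l) ℚ.+ (ℚ.- inv ℚ.* toℚ (u′ l) ℚ.+ 0ℚ))) (combo≡p l) ⟩
        toℚ (p l) ℚ.+ (inv ℚ.* toℚ (u l) ℚ.+ (ℚ.- inv ℚ.* toℚ (u′ l) ℚ.+ 0ℚ))
          ≡⟨ solve 4 (λ a b x y → a :+ (b :* x :+ (:- b :* y :+ con 0ℚ)) := a :+ b :* (x :- y)) refl
                     (toℚ (p l)) inv (toℚ (u l)) (toℚ (u′ l)) ⟩
        toℚ (p l) ℚ.+ inv ℚ.* (toℚ (u l) ℚ.- toℚ (u′ l))                      ≡⟨ cong (λ z → toℚ (p l) ℚ.+ inv ℚ.* z) (sym (toℚ-- (u l) (u′ l))) ⟩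
        toℚ (p l) ℚ.+ inv ℚ.* toℚ (u l - u′ l)                                ≡⟨ cong (λ z → toℚ (p l) ℚ.+ inv ℚ.* toℚ z) (u-u′ l) ⟩
        toℚ (p l) ℚ.+ inv ℚ.* toℚ (+ suc g * root i j l)
          ≡⟨ cong (λ z → toℚ (p l) ℚ.+ inv ℚ.* z) (trans (toℚ-* (+ suc g) (root i j l)) (cong (ℚ._* toℚ (root i j l)) (toℚ-mkℚ (+ suc g)))) ⟩
        toℚ (p l) ℚ.+ inv ℚ.* (widthℚ ℚ.* toℚ (root i j l))
          ≡⟨ cong (toℚ (p l) ℚ.+_) (trans (sym (ℚP.*-assoc inv widthℚ (toℚ (root i j l))))
                                          (trans (cong (ℚ._* toℚ (root i j l)) (ℚP.*-inverseˡ widthℚ)) (ℚP.*-identityˡ _))) ⟩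
        toℚ (p l) ℚ.+ toℚ (root i j l)                                        ≡⟨ sym (toℚ-+ (p l) (root i j l)) ⟩
        toℚ (p l + root i j l) ∎
        where open ≡-Reasoning

    module Centre (d : ℤ) (N≡nd : N ≡ + n * d) where

      open Rotation n-1

      centre : Point n
      centre _ = d

      private
        nℚ : ℚ
        nℚ = mkℚ (+ n) 0 (coprime-1 n)

        rotated : Fin n → ℚ × Σ (Point n) S
        rotated r = ℚ.1/ nℚ , (λ l → + lam (rotate r ⟨$⟩ʳ l)) , (rotate r , λ _ → refl)

      -- the centre is the average of the n cyclic rotations of λ
      centre-conv : InConv S centre
      centre-conv = tabulate rotated , allNonneg-tabulate rotated (λ _ → ℚ.*≤* (ℤ.+≤+ ℕ.z≤n)) , ∑w≡1 , combo≡d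
        where
        open ≡-Reasoning
        ∑w≡1 : weightSum (tabulate rotated) ≡ 1ℚ
        ∑w≡1 = begin
          weightSum (tabulate rotated)        ≡⟨ weightSum-tabulate rotated ⟩
          sumℚ n (λ _ → ℚ.1/ nℚ)              ≡⟨ sumℚ-const n (ℚ.1/ nℚ) ⟩
          toℚ (+ n) ℚ.* ℚ.1/ nℚ               ≡⟨ cong (ℚ._* ℚ.1/ nℚ) (toℚ-mkℚ (+ n)) ⟩
          nℚ ℚ.* ℚ.1/ nℚ                      ≡⟨ ℚP.*-inverseʳ nℚ ⟩
          1ℚ ∎
        combo≡d : ∀ i → combo (tabulate rotated) i ≡ toℚ d
        combo≡d i = begin
          combo (tabulate rotated) i                                 ≡⟨ combo-tabulate rotated i ⟩
          sumℚ n (λ r → ℚ.1/ nℚ ℚ.* toℚ (+ lam (rotate r ⟨$⟩ʳ i)))   ≡⟨ sumℚ-*ˡ (ℚ.1/ nℚ) (λ r → toℚ (+ lam (rotate r ⟨$⟩ʳ i))) ⟩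
          ℚ.1/ nℚ ℚ.* sumℚ n (λ r → toℚ (+ lam (rotate r ⟨$⟩ʳ i)))   ≡⟨ cong (ℚ.1/ nℚ ℚ.*_) (sumℚ-toℚ (λ r → + lam (rotate r ⟨$⟩ʳ i))) ⟩
          ℚ.1/ nℚ ℚ.* toℚ (sumFinℤ n (λ r → + lam (rotate r ⟨$⟩ʳ i))) ≡⟨ cong (λ z → ℚ.1/ nℚ ℚ.* toℚ z) (trans (sum-rotate (asPoint lam) i) N≡nd) ⟩
          ℚ.1/ nℚ ℚ.* toℚ (+ n * d)                                  ≡⟨ cong (ℚ.1/ nℚ ℚ.*_) (trans (toℚ-* (+ n) d) (cong (ℚ._* toℚ d) (toℚ-mkℚ (+ n)))) ⟩
          ℚ.1/ nℚ ℚ.* (nℚ ℚ.* toℚ d)                                 ≡⟨ sym (ℚP.*-assoc (ℚ.1/ nℚ) nℚ (toℚ d)) ⟩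
          (ℚ.1/ nℚ ℚ.* nℚ) ℚ.* toℚ d                                 ≡⟨ cong (ℚ._* toℚ d) (ℚP.*-inverseˡ nℚ) ⟩
          1ℚ ℚ.* toℚ d                                               ≡⟨ ℚP.*-identityˡ (toℚ d) ⟩
          toℚ d ∎

      sum-dot-rotations : ∀ a {v} → S v → sumFinℤ n (λ r → dot a (λ l → v (rotate r ⟨$⟩ʳ l))) ≡ + n * dot a centre
      sum-dot-rotations a {v} Sv = begin
        sumFinℤ n (λ r → sumFinℤ n (λ l → a l * v (rotate r ⟨$⟩ʳ l)))  ≡⟨ sum-comm (λ r l → a l * v (rotate r ⟨$⟩ʳ l)) ⟩
        sumFinℤ n (λ l → sumFinℤ n (λ r → a l * v (rotate r ⟨$⟩ʳ l)))  ≡⟨ sum-cong (λ l → sum-*ˡ (a l) (λ r → v (rotate r ⟨$⟩ʳ l))) ⟩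
        sumFinℤ n (λ l → a l * sumFinℤ n (λ r → v (rotate r ⟨$⟩ʳ l)))  ≡⟨ sum-cong (λ l → cong (a l *_) (trans (sum-rotate v l) (trans (orbit-sum lam Sv) N≡nd))) ⟩
        sumFinℤ n (λ l → a l * (+ n * d))                             ≡⟨ sum-cong (λ l → reorder (a l) (+ n) d) ⟩
        sumFinℤ n (λ l → + n * (a l * d))                             ≡⟨ sum-*ˡ (+ n) (λ l → a l * d) ⟩
        + n * dot a centre ∎
        where
        open ≡-Reasoning
        reorder : ∀ x y z → x * (y * z) ≡ y * (x * z)
        reorder = solve-∀

      -- the rotations of a vertex average to the centre, so one of them lies above it unless all are level with it
      rotation-above-or-level : ∀ a {v} → S v → (∃ λ u → S u × dot a centre < dot a u) ⊎ dot a v ≡ dot a centre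
      rotation-above-or-level a {v} Sv with argmax (λ r → dot a (λ l → v (rotate r ⟨$⟩ʳ l)))
      ... | r , ≤max with dot a centre ℤ.<? dot a (λ l → v (rotate r ⟨$⟩ʳ l))
      ...   | yes above = inj₁ (_ , orbit-permute lam Sv (rotate r) , above)
      ...   | no  ¬above = inj₂ (trans (sum-cong (λ l → cong (λ z → a l * v z) (sym (rotate-zero l)))) (all-level Fin.zero))
        where
        all-level : ∀ r → dot a (λ l → v (rotate r ⟨$⟩ʳ l)) ≡ dot a centre
        all-level = sum-mono-≤-≡⇒≡ (λ r′ → ℤP.≤-trans (≤max r′) (ℤP.≮⇒≥ ¬above))
                                    (trans (sum-dot-rotations a Sv) (sym (sum-const n (dot a centre))))

      centre-relint : RelInt S centre
      centre-relint = centre-conv , above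
        where
        above : ∀ a → ProperFace S a → ∃ λ v → S v × dot a centre < dot a v
        above a (w₁ , w₂ , Sw₁ , Sw₂ , w₁<w₂) with rotation-above-or-level a Sw₁ | rotation-above-or-level a Sw₂
        ... | inj₁ found | _         = found
        ... | inj₂ _     | inj₁ found = found
        ... | inj₂ w₁≡c  | inj₂ w₂≡c  = ⊥-elim (ℤP.<-irrefl (trans w₁≡c (sym w₂≡c)) w₁<w₂)

    facet-at-distance-one : ∀ {p} → RelInt S p → FacetsAtDistanceOne S p →
      ∀ {χ w₀ i j} → Facet S χ → MaxAt S χ w₀ → χ i ≡ + 1 → χ j ≡ + 0 → dot χ w₀ ≡ dot χ p + + 1
    facet-at-distance-one {p} (p-conv , p-relint) distance-one {χ} {w₀} {i} {j} χ-facet χ-w₀ χi≡1 χj≡0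
      with p-relint χ (proj₁ χ-facet) | (dot χ p + + 1) ℤ.≟ dot χ w₀
    ... | _ | yes ≡w₀ = sym ≡w₀
    ... | v , Sv , p<v | no  ≢w₀ = ⊥-elim (distance-one χ χ-facet w₀ χ-w₀ x (root-in-aff {p} p-conv i≢j) (p<x , x<w₀))
      where
      i≢j : i ≢ j
      i≢j i≡j = ℤP.<-irrefl (trans (sym χj≡0) (trans (cong χ (sym i≡j)) χi≡1)) (ℤ.+<+ (ℕ.s≤s ℕ.z≤n))
      x : Point n
      x l = p l + root i j l
      χx≡ : dot χ x ≡ dot χ p + + 1
      χx≡ = trans (dot-+ʳ χ p (root i j)) (cong (λ s → dot χ p + s) (trans (dot-rootʳ χ i j) (cong₂ _-_ χi≡1 χj≡0)))
      p<x : dot χ p < dot χ x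
      p<x = subst (dot χ p <_) (sym χx≡) (<-+1 (dot χ p))
      x<w₀ : dot χ x < dot χ w₀
      x<w₀ = subst (_< dot χ w₀) (sym χx≡) (ℤP.≤∧≢⇒< (ℤP.≤-trans (<⇒+1≤ p<v) (proj₂ χ-w₀ v Sv)) ≢w₀)

    -- with the centre as interior point, a facet normal can be replaced by its 0/1 normal χ (facet-two-valued)
    reflexive-if-bounded : ∀ d → N ≡ + n * d →
      (∀ {χ v} → Binary χ → Facet S χ → MaxAt S χ v → dot χ v ≤ d * sumFinℤ n χ + + 1) → Reflexive S
    reflexive-if-bounded d N≡nd bounded = centre , centre-relint , distance-one
      where
      open Centre d N≡nd
      distance-one : FacetsAtDistanceOne S centre
      distance-one a a-facet v a-v x x-aff (c<x , x<v) with facet-two-valued {a} {v} a-facet a-v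
      ... | χ , χ-bin , h , g , 0<g , a≡ = ℤP.<-irrefl refl (ℤP.<-≤-trans χx<χv (ℤP.≤-trans χv≤ (<⇒+1≤ χc<χx)))
        where
        dot-a : ∀ y → sumFinℤ n y ≡ N → dot a y ≡ h * N + g * dot χ y
        dot-a y ∑y≡N = trans (dot-affine {a = a} {χ} h g a≡ y) (cong (λ s → h * s + g * dot χ y) ∑y≡N)
        ∑c≡N : sumFinℤ n centre ≡ N
        ∑c≡N = trans (sum-const n d) (sym N≡nd)
        ∑v≡N : sumFinℤ n v ≡ N
        ∑v≡N = orbit-sum lam {v} (proj₁ a-v)
        χc<χx : dot χ centre < dot χ x
        χc<χx = affine-cancel-< (h * N) 0<g (subst₂ _<_ (dot-a centre ∑c≡N) (dot-a x (aff-sum lam {x} x-aff)) c<x)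
        χx<χv : dot χ x < dot χ v
        χx<χv = affine-cancel-< (h * N) 0<g (subst₂ _<_ (dot-a x (aff-sum lam {x} x-aff)) (dot-a v ∑v≡N) x<v)
        χc≡ : dot χ centre ≡ d * sumFinℤ n χ
        χc≡ = trans (sum-cong (λ l → ℤP.*-comm (χ l) d)) (sum-*ˡ d χ)
        χv≤ : dot χ v ≤ dot χ centre + + 1
        χv≤ = subst (λ z → dot χ v ≤ z + + 1) (sym χc≡)
                (bounded χ-bin (affine-facet lam h g a≡ 0<g a-facet) (affine-face⊆ lam h g a≡ 0<g v a-v))

  module Bounds {n-1 : ℕ} (lam : Fin (suc n-1) → ℕ) (partition : IsPartition lam)
                (gap : lam (Fin.fromℕ n-1) ℕ.< lam Fin.zero) where

    open Facets lam gap

    ≤top : ∀ {v} → S v → ∀ i → v i ≤ top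
    ≤top (σ , v≡) i rewrite v≡ i = ℤ.+≤+ (partition Fin.zero _ ℕ.z≤n)

    bottom≤ : ∀ {v} → S v → ∀ i → bottom ≤ v i
    bottom≤ (σ , v≡) i rewrite v≡ i = ℤ.+≤+ (partition _ last (FinP.≤fromℕ _))

    dot-≤-top : ∀ {χ v} → Binary χ → S v → dot χ v ≤ top * sumFinℤ n χ
    dot-≤-top {χ} {v} χ-bin Sv = begin
      dot χ v                      ≤⟨ sum-mono-≤ (λ l → binary-*-mono χ-bin l (≤top Sv l)) ⟩
      sumFinℤ n (λ l → χ l * top)  ≡⟨ trans (sum-cong (λ l → ℤP.*-comm (χ l) top)) (sum-*ˡ top χ) ⟩
      top * sumFinℤ n χ ∎
      where open ℤP.≤-Reasoning

    dot-via-complement : ∀ χ {v} → S v → dot χ v ≡ N - dot (complement χ) v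
    dot-via-complement χ {v} Sv = begin
      dot χ v                                ≡⟨ flip (dot χ v) (sumFinℤ n v) ⟩
      sumFinℤ n v - (sumFinℤ n v - dot χ v)  ≡⟨ cong₂ _-_ (orbit-sum lam Sv) (sym (dot-complement χ v)) ⟩
      N - dot (complement χ) v ∎
      where
      open ≡-Reasoning
      flip : ∀ d s → d ≡ s - (s - d)
      flip = solve-∀

    dot-≤-bottom : ∀ {χ v} → Binary χ → S v → dot χ v ≤ N - bottom * sumFinℤ n (complement χ)
    dot-≤-bottom {χ} {v} χ-bin Sv = begin
      dot χ v                                        ≡⟨ dot-via-complement χ Sv ⟩
      N - dot (complement χ) v                       ≤⟨ ℤP.+-monoʳ-≤ N (ℤP.neg-mono-≤ bottom-part) ⟩
      N - bottom * sumFinℤ n (complement χ) ∎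
      where
      open ℤP.≤-Reasoning
      bottom-part : bottom * sumFinℤ n (complement χ) ≤ dot (complement χ) v
      bottom-part = begin
        bottom * sumFinℤ n (complement χ)
          ≡⟨ sym (trans (sum-cong (λ l → ℤP.*-comm (complement χ l) bottom)) (sum-*ˡ bottom (complement χ))) ⟩
        sumFinℤ n (λ l → complement χ l * bottom)
          ≤⟨ sum-mono-≤ (λ l → binary-*-mono (complement-binary χ-bin) l (bottom≤ Sv l)) ⟩
        dot (complement χ) v ∎

    top-face : ∀ {χ w} → Binary χ → S w → (∀ l → χ l ≡ + 1 → w l ≡ top) → MaxAt S χ w
    top-face {χ} {w} χ-bin Sw ones-top = Sw , λ w′ Sw′ → ℤP.≤-trans (dot-≤-top χ-bin Sw′) (ℤP.≤-reflexive attained)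
      where
      attained : top * sumFinℤ n χ ≡ dot χ w
      attained = trans (sym (trans (sum-cong (λ l → ℤP.*-comm (χ l) top)) (sum-*ˡ top χ))) (sum-cong at)
        where
        at : ∀ l → χ l * top ≡ χ l * w l
        at l with χ-bin l
        ... | inj₁ χl≡0 rewrite χl≡0 = refl
        ... | inj₂ χl≡1 rewrite χl≡1 = cong (+ 1 *_) (sym (ones-top l χl≡1))

    bottom-face : ∀ {χ w} → Binary χ → S w → (∀ l → χ l ≡ + 0 → w l ≡ bottom) → MaxAt S χ w
    bottom-face {χ} {w} χ-bin Sw zeros-bottom = Sw , λ w′ Sw′ → ℤP.≤-trans (dot-≤-bottom χ-bin Sw′) (ℤP.≤-reflexive attained)
      where
      attained : N - bottom * sumFinℤ n (complement χ) ≡ dot χ w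
      attained = trans (cong (λ s → N - s) (trans (sym (trans (sum-cong (λ l → ℤP.*-comm (complement χ l) bottom))
                                                         (sum-*ˡ bottom (complement χ))))
                                           (sum-cong at)))
                       (sym (dot-via-complement χ Sw))
        where
        at : ∀ l → complement χ l * bottom ≡ complement χ l * w l
        at l with χ-bin l
        ... | inj₁ χl≡0 rewrite χl≡0 = cong (+ 1 *_) (sym (zeros-bottom l χl≡0))
        ... | inj₂ χl≡1 rewrite χl≡1 = refl

    multiplicity : ℤ → ℤ
    multiplicity t = sumFinℤ n (λ j → indicator (+ lam j ℤ.≟ t))

    multiplicity-orbit : ∀ {v} → S v → ∀ t → sumFinℤ n (λ l → indicator (v l ℤ.≟ t)) ≡ multiplicity t
    multiplicity-orbit Sv t = orbit-sum-map lam Sv (λ z → indicator (z ℤ.≟ t))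

    binary-≤-multiplicity : ∀ {ι t} → Binary ι → (∀ j → ι j ≡ + 1 → + lam j ≡ t) → sumFinℤ n ι ≤ multiplicity t
    binary-≤-multiplicity {ι} {t} ι-bin at-t = sum-mono-≤ ≤indicator
      where
      ≤indicator : ∀ j → ι j ≤ indicator (+ lam j ℤ.≟ t)
      ≤indicator j with ι-bin j
      ... | inj₁ ιj≡0 rewrite ιj≡0 = binary-nonneg (indicator-binary (λ j → + lam j ℤ.≟ t)) j
      ... | inj₂ ιj≡1 rewrite ιj≡1 | indicator-yes (+ lam j ℤ.≟ t) (at-t j ιj≡1) = ℤP.≤-refl

    ones-at-top : ∀ {χ w} → Binary χ → sumFinℤ n χ ≤ multiplicity top → MaxAt S χ w → ∀ i → χ i ≡ + 1 → w i ≡ top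
    ones-at-top {χ} {w} χ-bin ∑χ≤ w-max@(Sw , _) i χi≡1 with w i ℤ.≟ top
    ... | yes wi≡top = wi≡top
    ... | no  wi≢top = ⊥-elim (ℤP.<-irrefl refl (≤-1⇒< (ℤP.≤-trans ∑χ≤ mult≤)))
      where
      κ : Point n
      κ l = indicator (w l ℤ.≟ top)
      κ≤ : ∀ l → κ l ≤ χ l - δ i l
      κ≤ l with l FinP.≟ i
      ... | yes refl rewrite indicator-no (w l ℤ.≟ top) wi≢top | χi≡1 | δ-diag l = ℤP.≤-refl
      ... | no  l≢i rewrite δ-off i l (l≢i ∘ sym) with χ-bin l
      ...   | inj₂ χl≡1 rewrite χl≡1 = binary-≤1 (indicator-binary (λ l → w l ℤ.≟ top)) l
      ...   | inj₁ χl≡0 rewrite χl≡0 = ℤP.≤-reflexive (indicator-no (w l ℤ.≟ top) (ℤP.<⇒≢ wl<top))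
        where
        wl<top : w l < top
        wl<top = ℤP.≤-<-trans (maximiser-sorted lam w-max (subst₂ _<_ (sym χl≡0) (sym χi≡1) (ℤ.+<+ (ℕ.s≤s ℕ.z≤n))))
                              (ℤP.≤∧≢⇒< (≤top Sw i) wi≢top)
      mult≤ : multiplicity top ≤ sumFinℤ n χ - + 1
      mult≤ = begin
        multiplicity top                    ≡⟨ sym (multiplicity-orbit Sw top) ⟩
        sumFinℤ n κ                         ≤⟨ sum-mono-≤ κ≤ ⟩
        sumFinℤ n (λ l → χ l - δ i l)       ≡⟨ trans (sum-- χ (δ i)) (cong (λ s → sumFinℤ n χ - s) (sum-δ i)) ⟩
        sumFinℤ n χ - + 1 ∎
        where open ℤP.≤-Reasoning

    zeros-at-bottom : ∀ {χ w} → Binary χ → sumFinℤ n (complement χ) ≤ multiplicity bottom → MaxAt S χ w →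
      ∀ j → χ j ≡ + 0 → w j ≡ bottom
    zeros-at-bottom {χ} {w} χ-bin ∑χ̅≤ w-max@(Sw , _) j χj≡0 with w j ℤ.≟ bottom
    ... | yes wj≡bottom = wj≡bottom
    ... | no  wj≢bottom = ⊥-elim (ℤP.<-irrefl refl (≤-1⇒< (ℤP.≤-trans ∑χ̅≤ mult≤)))
      where
      κ : Point n
      κ l = indicator (w l ℤ.≟ bottom)
      κ≤ : ∀ l → κ l ≤ complement χ l - δ j l
      κ≤ l with l FinP.≟ j
      ... | yes refl rewrite indicator-no (w l ℤ.≟ bottom) wj≢bottom | χj≡0 | δ-diag l = ℤP.≤-refl
      ... | no  l≢j rewrite δ-off j l (l≢j ∘ sym) with χ-bin l
      ...   | inj₁ χl≡0 rewrite χl≡0 = binary-≤1 (indicator-binary (λ l → w l ℤ.≟ bottom)) l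
      ...   | inj₂ χl≡1 rewrite χl≡1 = ℤP.≤-reflexive (indicator-no (w l ℤ.≟ bottom) (ℤP.<⇒≢ bottom<wl ∘ sym))
        where
        bottom<wl : bottom < w l
        bottom<wl = ℤP.<-≤-trans (ℤP.≤∧≢⇒< (bottom≤ Sw j) (wj≢bottom ∘ sym))
                                 (maximiser-sorted lam w-max (subst₂ _<_ (sym χj≡0) (sym χl≡1) (ℤ.+<+ (ℕ.s≤s ℕ.z≤n))))
      mult≤ : multiplicity bottom ≤ sumFinℤ n (complement χ) - + 1
      mult≤ = begin
        multiplicity bottom                          ≡⟨ sym (multiplicity-orbit Sw bottom) ⟩
        sumFinℤ n κ                                  ≤⟨ sum-mono-≤ κ≤ ⟩
        sumFinℤ n (λ l → complement χ l - δ j l)     ≡⟨ trans (sum-- (complement χ) (δ j)) (cong (λ s → sumFinℤ n (complement χ) - s) (sum-δ j)) ⟩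
        sumFinℤ n (complement χ) - + 1 ∎
        where open ℤP.≤-Reasoning

    -- otherwise dropping one of the ones of χ would keep every maximiser of χ, contradicting maximality
    facet-ones-exceed-top : ∀ {χ v} → Binary χ → Facet S χ → MaxAt S χ v → + 2 ≤ sumFinℤ n χ →
      multiplicity top < sumFinℤ n χ
    facet-ones-exceed-top {χ} {v} χ-bin (_ , maximal) v-max@(Sv , _) 2≤∑χ with sumFinℤ n χ ℤ.≤? multiplicity top
    ... | no  ∑χ≰ = ℤP.≰⇒> ∑χ≰
    ... | yes ∑χ≤ = ⊥-elim (ℤP.<-irrefl (trans (sym ui≡bottom) ui≡top) bottom<top)
      where
      top-ones : ∀ {w} → MaxAt S χ w → ∀ l → χ l ≡ + 1 → w l ≡ top
      top-ones = ones-at-top χ-bin ∑χ≤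
      i = proj₁ (binary-one χ-bin (ℤP.≤-trans (ℤ.+≤+ (ℕ.s≤s ℕ.z≤n)) 2≤∑χ))
      χi≡1 = proj₂ (binary-one χ-bin (ℤP.≤-trans (ℤ.+≤+ (ℕ.s≤s ℕ.z≤n)) 2≤∑χ))
      b : Point n
      b l = χ l - δ i l
      b-bin : Binary b
      b-bin = drop-one-binary χ-bin i χi≡1
      ∑b : sumFinℤ n b ≡ sumFinℤ n χ - + 1
      ∑b = trans (sum-- χ (δ i)) (cong (λ s → sumFinℤ n χ - s) (sum-δ i))
      1≤∑b : + 1 ≤ sumFinℤ n b
      1≤∑b = subst (+ 1 ≤_) (sym ∑b) (ℤP.+-monoˡ-≤ (- + 1) 2≤∑χ)
      i′ = proj₁ (binary-one b-bin 1≤∑b)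
      bi′≡1 = proj₂ (binary-one b-bin 1≤∑b)
      l₀ = proj₁ (orbit-attains lam Sv last)
      vl₀≡bottom : v l₀ ≡ bottom
      vl₀≡bottom = proj₂ (orbit-attains lam Sv last)
      χl₀≡0 : χ l₀ ≡ + 0
      χl₀≡0 = binary-≢1 χ-bin l₀ (λ χl₀≡1 → ℤP.<-irrefl (trans (sym vl₀≡bottom) (top-ones v-max l₀ χl₀≡1)) bottom<top)
      l₀≢i : l₀ ≢ i
      l₀≢i l₀≡i = ℤP.<-irrefl (trans (sym χl₀≡0) (trans (cong χ l₀≡i) χi≡1)) (ℤ.+<+ (ℕ.s≤s ℕ.z≤n))
      bl₀≡0 : b l₀ ≡ + 0
      bl₀≡0 = trans (cong (λ z → χ l₀ - z) (δ-off i l₀ (l₀≢i ∘ sym))) (trans (ℤP.+-identityʳ (χ l₀)) χl₀≡0)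
      χ⊆b : Face⊆ S χ b
      χ⊆b w w-max = top-face b-bin (proj₁ w-max) (λ l bl≡1 → top-ones w-max l (proj₂ (drop-one-ones χ-bin i bl≡1)))
      b⊆χ : Face⊆ S b χ
      b⊆χ = maximal b (proper-face {b} {i′} {l₀} (subst₂ _<_ (sym bl₀≡0) (sym bi′≡1) (ℤ.+<+ (ℕ.s≤s ℕ.z≤n)))) χ⊆b
      u : Point n
      u l = v (Perm.transpose i l₀ ⟨$⟩ʳ l)
      u-b : MaxAt S b u
      u-b = top-face b-bin (orbit-permute lam Sv (Perm.transpose i l₀)) λ l bl≡1 →
        let l≢i , χl≡1 = drop-one-ones χ-bin i bl≡1 in
        trans (cong v (transpose-other i l₀ l≢i λ l≡l₀ → ℤP.<-irrefl (trans (sym bl₀≡0) (trans (cong b (sym l≡l₀)) bl≡1)) (ℤ.+<+ (ℕ.s≤s ℕ.z≤n))))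
              (top-ones v-max l χl≡1)
      ui≡top : u i ≡ top
      ui≡top = top-ones (b⊆χ u u-b) i χi≡1
      ui≡bottom : u i ≡ bottom
      ui≡bottom = trans (cong v (transpose-matchˡ i l₀)) vl₀≡bottom

    facet-zeros-exceed-bottom : ∀ {χ v} → Binary χ → Facet S χ → MaxAt S χ v → + 2 ≤ sumFinℤ n (complement χ) →
      multiplicity bottom < sumFinℤ n (complement χ)
    facet-zeros-exceed-bottom {χ} {v} χ-bin (_ , maximal) v-max@(Sv , _) 2≤∑χ̅ with sumFinℤ n (complement χ) ℤ.≤? multiplicity bottom
    ... | no  ∑χ̅≰ = ℤP.≰⇒> ∑χ̅≰
    ... | yes ∑χ̅≤ = ⊥-elim (ℤP.<-irrefl (trans (sym uj≡bottom) uj≡top) bottom<top)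
      where
      bottom-zeros : ∀ {w} → MaxAt S χ w → ∀ l → χ l ≡ + 0 → w l ≡ bottom
      bottom-zeros = zeros-at-bottom χ-bin ∑χ̅≤
      1≤∑χ̅ : + 1 ≤ sumFinℤ n (complement χ)
      1≤∑χ̅ = ℤP.≤-trans (ℤ.+≤+ (ℕ.s≤s ℕ.z≤n)) 2≤∑χ̅
      j = proj₁ (binary-one (complement-binary χ-bin) 1≤∑χ̅)
      χj≡0 : χ j ≡ + 0
      χj≡0 = complement-one χ-bin (proj₂ (binary-one (complement-binary χ-bin) 1≤∑χ̅))
      b : Point n
      b l = χ l + δ j l
      b-bin : Binary b
      b-bin = add-one-binary χ-bin j χj≡0
      ∑b̅ : sumFinℤ n (complement b) ≡ sumFinℤ n (complement χ) - + 1
      ∑b̅ = begin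
        sumFinℤ n (complement b)              ≡⟨ sum-complement b ⟩
        + n - sumFinℤ n b                     ≡⟨ cong (λ s → + n - s) (trans (sum-+ χ (δ j)) (cong (λ s → sumFinℤ n χ + s) (sum-δ j))) ⟩
        + n - (sumFinℤ n χ + + 1)             ≡⟨ shift (+ n) (sumFinℤ n χ) ⟩
        + n - sumFinℤ n χ - + 1               ≡⟨ cong (_- + 1) (sym (sum-complement χ)) ⟩
        sumFinℤ n (complement χ) - + 1 ∎
        where
        open ≡-Reasoning
        shift : ∀ a s → a - (s + + 1) ≡ a - s - + 1
        shift = solve-∀
      1≤∑b̅ : + 1 ≤ sumFinℤ n (complement b)
      1≤∑b̅ = subst (+ 1 ≤_) (sym ∑b̅) (ℤP.+-monoˡ-≤ (- + 1) 2≤∑χ̅)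
      j′ = proj₁ (binary-one (complement-binary b-bin) 1≤∑b̅)
      bj′≡0 : b j′ ≡ + 0
      bj′≡0 = complement-one b-bin (proj₂ (binary-one (complement-binary b-bin) 1≤∑b̅))
      l₁ = proj₁ (orbit-attains lam Sv Fin.zero)
      vl₁≡top : v l₁ ≡ top
      vl₁≡top = proj₂ (orbit-attains lam Sv Fin.zero)
      χl₁≡1 : χ l₁ ≡ + 1
      χl₁≡1 = binary-≢0 χ-bin l₁ (λ χl₁≡0 → ℤP.<-irrefl (trans (sym (bottom-zeros v-max l₁ χl₁≡0)) vl₁≡top) bottom<top)
      l₁≢j : l₁ ≢ j
      l₁≢j l₁≡j = ℤP.<-irrefl (trans (sym χj≡0) (trans (cong χ (sym l₁≡j)) χl₁≡1)) (ℤ.+<+ (ℕ.s≤s ℕ.z≤n))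
      bl₁≡1 : b l₁ ≡ + 1
      bl₁≡1 = trans (cong (λ z → χ l₁ + z) (δ-off j l₁ (l₁≢j ∘ sym))) (trans (ℤP.+-identityʳ (χ l₁)) χl₁≡1)
      χ⊆b : Face⊆ S χ b
      χ⊆b w w-max = bottom-face b-bin (proj₁ w-max) (λ l bl≡0 → bottom-zeros w-max l (proj₂ (add-one-zeros χ-bin j bl≡0)))
      b⊆χ : Face⊆ S b χ
      b⊆χ = maximal b (proper-face {b} {l₁} {j′} (subst₂ _<_ (sym bj′≡0) (sym bl₁≡1) (ℤ.+<+ (ℕ.s≤s ℕ.z≤n)))) χ⊆b
      u : Point n
      u l = v (Perm.transpose j l₁ ⟨$⟩ʳ l)
      u-b : MaxAt S b u
      u-b = bottom-face b-bin (orbit-permute lam Sv (Perm.transpose j l₁)) λ l bl≡0 →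
        let l≢j , χl≡0 = add-one-zeros χ-bin j bl≡0 in
        trans (cong v (transpose-other j l₁ l≢j λ l≡l₁ → ℤP.<-irrefl (trans (sym χl≡0) (trans (cong χ l≡l₁) χl₁≡1)) (ℤ.+<+ (ℕ.s≤s ℕ.z≤n))))
              (bottom-zeros v-max l χl≡0)
      uj≡bottom : u j ≡ bottom
      uj≡bottom = bottom-zeros (b⊆χ u u-b) j χj≡0
      uj≡top : u j ≡ top
      uj≡top = trans (cong v (transpose-matchˡ j l₁)) vl₁≡top

    μ : Fin n → ℕ
    μ i = lam i ℕ.∸ lam last

    μ-partition : IsPartition μ
    μ-partition i j i≤j = ℕP.∸-monoˡ-≤ (lam last) (partition i j i≤j)

    μ-last : μ last ≡ 0
    μ-last = ℕP.n∸n≡0 (lam last)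

    lam≡ : ∀ i → + lam i ≡ bottom + + μ i
    lam≡ i = cong +_ (trans (sym (ℕP.m∸n+n≡m (partition i last (FinP.≤fromℕ i)))) (ℕP.+-comm (μ i) (lam last)))

    N≡ : N ≡ + n * bottom + sumFinℤ n (λ i → + μ i)
    N≡ = trans (sum-cong lam≡) (trans (sum-+ (λ _ → bottom) (λ i → + μ i)) (cong (_+ sumFinℤ n (λ i → + μ i)) (sum-const n bottom)))

    μ≗ : ∀ {f} → (∀ i → + μ i ≡ + f i) → μ ≗ f
    μ≗ μ≡f i = ℤP.+-injective (μ≡f i)

    dot-≤-below-top : ∀ {χ v} → Binary χ → S v → dot χ v ≤ (top - + 1) * sumFinℤ n χ + multiplicity top
    dot-≤-below-top {χ} {v} χ-bin Sv = begin
      dot χ v                                                             ≤⟨ sum-mono-≤ termwise ⟩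
      sumFinℤ n (λ l → (top - + 1) * χ l + indicator (v l ℤ.≟ top))
        ≡⟨ trans (sum-+ (λ l → (top - + 1) * χ l) (λ l → indicator (v l ℤ.≟ top)))
                 (cong₂ _+_ (sum-*ˡ (top - + 1) χ) (multiplicity-orbit Sv top)) ⟩
      (top - + 1) * sumFinℤ n χ + multiplicity top ∎
      where
      open ℤP.≤-Reasoning
      termwise : ∀ l → χ l * v l ≤ (top - + 1) * χ l + indicator (v l ℤ.≟ top)
      termwise l with χ-bin l
      ... | inj₁ χl≡0 rewrite χl≡0 | ℤP.*-zeroʳ (top - + 1) | ℤP.+-identityˡ (indicator (v l ℤ.≟ top)) = indicator-nonneg (v l ℤ.≟ top)
      ... | inj₂ χl≡1 rewrite χl≡1 | ℤP.*-identityˡ (v l) | ℤP.*-identityʳ (top - + 1) with v l ℤ.≟ top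
      ...   | yes vl≡top rewrite vl≡top = ℤP.≤-reflexive (restore top)
        where
        restore : ∀ t → t ≡ t - + 1 + + 1
        restore = solve-∀
      ...   | no  vl≢top = subst (v l ≤_) (pred≡ top) (ℤP.i<j⇒i≤pred[j] (ℤP.≤∧≢⇒< (≤top Sv l) vl≢top))
        where
        pred≡ : ∀ t → - + 1 + t ≡ t - + 1 + + 0
        pred≡ = solve-∀

  fam1-prefix : ∀ m (i : Fin m) → + fam1 m i ≡ + m * prefix 1 i
  fam1-prefix m Fin.zero    = sym (ℤP.*-identityʳ (+ m))
  fam1-prefix m (Fin.suc i) = sym (ℤP.*-zeroʳ (+ m))

  fam2-prefix : ∀ k (i : Fin (suc (suc k))) → + fam2 (suc (suc k)) i ≡ prefix 1 i + prefix (suc k) i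
  fam2-prefix k Fin.zero    = refl
  fam2-prefix k (Fin.suc i) with ℕP.<-cmp (toℕ i) k
  ... | tri< i<k i≢k _ rewrite if-≡ᵇ-≢ {x = toℕ i} {k} 0 1 i≢k | prefix-< k i i<k = refl
  ... | tri≈ _ i≡k _   rewrite if-≡ᵇ-≡ {x = toℕ i} {k} 0 1 i≡k | prefix-≥ k i (ℕP.≤-reflexive (sym i≡k)) = refl
  ... | tri> _ _ k<i   = ⊥-elim (ℕP.<⇒≱ k<i (ℕ.s≤s⁻¹ (FinP.toℕ<n i)))

  fam3-prefix : ∀ m (i : Fin m) → + fam3 m i ≡ + 2 * prefix (m / 2) i
  fam3-prefix m i with toℕ i <ᵇ m / 2
  ... | true  = refl
  ... | false = refl

  fam4-prefix : ∀ m (i : Fin m) → + fam4 m i ≡ prefix (suc (m / 2)) i + prefix (m / 2) i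
  fam4-prefix m i with ℕP.<-cmp (toℕ i) (m / 2)
  ... | tri< i<h _ _ rewrite if-<ᵇ-< {x = toℕ i} {m / 2} 2 (if toℕ i ≡ᵇ m / 2 then 1 else 0) i<h
                           | prefix-< (suc (m / 2)) i (ℕP.m<n⇒m<1+n i<h) | prefix-< (m / 2) i i<h = refl
  ... | tri≈ _ i≡h _ rewrite if-<ᵇ-≥ {x = toℕ i} {m / 2} 2 (if toℕ i ≡ᵇ m / 2 then 1 else 0) (ℕP.≤-reflexive (sym i≡h))
                           | if-≡ᵇ-≡ {x = toℕ i} {m / 2} 1 0 i≡h
                           | prefix-< (suc (m / 2)) i (ℕ.s≤s (ℕP.≤-reflexive i≡h)) | prefix-≥ (m / 2) i (ℕP.≤-reflexive (sym i≡h)) = refl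
  ... | tri> _ i≢h h<i rewrite if-<ᵇ-≥ {x = toℕ i} {m / 2} 2 (if toℕ i ≡ᵇ m / 2 then 1 else 0) (ℕP.<⇒≤ h<i)
                             | if-≡ᵇ-≢ {x = toℕ i} {m / 2} 1 0 i≢h
                             | prefix-≥ (suc (m / 2)) i h<i | prefix-≥ (m / 2) i (ℕP.<⇒≤ h<i) = refl

  fam5-prefix : ∀ k (i : Fin (suc (suc k))) → + fam5 (suc (suc k)) i ≡ + suc (suc k) * prefix (suc k) i
  fam5-prefix k i with toℕ i <ᵇ suc k
  ... | true  = sym (ℤP.*-identityʳ (+ suc (suc k)))
  ... | false = sym (ℤP.*-zeroʳ (+ suc (suc k)))

  dot-permuteˡ : ∀ {m} (c q : Point m) (π : Permutation′ m) → dot (λ l → c (π ⟨$⟩ʳ l)) q ≡ dot c (λ i → q (π ⟨$⟩ˡ i))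
  dot-permuteˡ c q π = trans (sum-cong (λ l → cong (λ z → c (π ⟨$⟩ʳ l) * q z) (sym (Perm.inverseˡ π))))
                             (sum-permute (λ i → c i * q (π ⟨$⟩ˡ i)) π)

  module Necessity {k : ℕ} (lam : Fin (suc (suc k)) → ℕ) (partition : IsPartition lam)
                   (gap : lam (Fin.fromℕ (suc k)) ℕ.< lam Fin.zero) where

    open Facets lam gap
    open Bounds lam partition gap using (μ; μ-partition; μ-last; lam≡; N≡; μ≗)

    module _ (π : Permutation′ n) (s : ℕ) (0<s : 0 ℕ.< s) (s≤k+1 : s ℕ.≤ suc k)
             (ones-spread : s ≡ 1 ⊎ ∃ λ a → toℕ a ℕ.< s × lam a ≢ lam Fin.zero)
             (zeros-spread : s ≡ suc k ⊎ ∃ λ b → s ℕ.≤ toℕ b × lam b ≢ lam last) where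

      private
        χ w₀ : Point n
        χ l  = prefix s (π ⟨$⟩ʳ l)
        w₀ l = + lam (π ⟨$⟩ʳ l)

        χ-bin : Binary χ
        χ-bin l = prefix-binary s (π ⟨$⟩ʳ l)

        χ-at-π⁻¹ : ∀ a → χ (π ⟨$⟩ˡ a) ≡ prefix s a
        χ-at-π⁻¹ a = cong (prefix s) (Perm.inverseʳ π)

        χx₁≡1 : χ (π ⟨$⟩ˡ Fin.zero) ≡ + 1
        χx₁≡1 = trans (χ-at-π⁻¹ Fin.zero) (prefix-< {n} s Fin.zero 0<s)

        χx₀≡0 : χ (π ⟨$⟩ˡ last) ≡ + 0
        χx₀≡0 = trans (χ-at-π⁻¹ last) (prefix-≥ {n} s last (subst (s ℕ.≤_) (sym (FinP.toℕ-fromℕ (suc k))) s≤k+1))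

        at-π⁻¹ : ∀ {i j} → π ⟨$⟩ʳ i ≡ j → i ≡ π ⟨$⟩ˡ j
        at-π⁻¹ refl = sym (Perm.inverseˡ π)

        w₀-injective : ∀ {a b} → w₀ (π ⟨$⟩ˡ a) ≡ w₀ (π ⟨$⟩ˡ b) → lam a ≡ lam b
        w₀-injective e = ℤP.+-injective (trans (cong (λ z → + lam z) (sym (Perm.inverseʳ π)))
                                               (trans e (cong (λ z → + lam z) (Perm.inverseʳ π))))

        spread₁ : (s ≡ 1 ⊎ ∃ λ a → toℕ a ℕ.< s × lam a ≢ lam Fin.zero) → Spread χ (+ 1) w₀ (π ⟨$⟩ˡ Fin.zero)
        spread₁ (inj₁ s≡1) = inj₁ λ i χi≡1 →
          at-π⁻¹ (FinP.toℕ-injective (ℕP.n<1⇒n≡0 (subst (_ ℕ.<_) s≡1 (prefix-one s _ χi≡1))))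
        spread₁ (inj₂ (a , a<s , λa≢λ0)) =
          inj₂ (π ⟨$⟩ˡ a , trans (χ-at-π⁻¹ a) (prefix-< s a a<s) , λa≢λ0 ∘ sym ∘ w₀-injective)

        spread₀ : (s ≡ suc k ⊎ ∃ λ b → s ℕ.≤ toℕ b × lam b ≢ lam last) → Spread χ (+ 0) w₀ (π ⟨$⟩ˡ last)
        spread₀ (inj₁ s≡k+1) = inj₁ λ i χi≡0 →
          at-π⁻¹ (FinP.toℕ-injective (ℕP.≤-antisym (FinP.≤fromℕ (π ⟨$⟩ʳ i))
            (subst₂ ℕ._≤_ (trans s≡k+1 (sym (FinP.toℕ-fromℕ (suc k)))) refl (prefix-zero s _ χi≡0))))
        spread₀ (inj₂ (b , s≤b , λb≢λlast)) =
          inj₂ (π ⟨$⟩ˡ b , trans (χ-at-π⁻¹ b) (prefix-≥ s b s≤b) , λb≢λlast ∘ sym ∘ w₀-injective)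

        maximiser : MaxAt S χ w₀
        maximiser = sorted⇒maximiser lam χ-bin (π , λ _ → refl) λ i j χi≡1 χj≡0 →
          ℤ.+≤+ (partition (π ⟨$⟩ʳ i) (π ⟨$⟩ʳ j) (ℕP.<⇒≤ (ℕP.<-≤-trans (prefix-one s _ χi≡1) (prefix-zero s _ χj≡0))))

        facet : Facet S χ
        facet = binary-facet χ-bin maximiser χx₁≡1 χx₀≡0 (spread₁ ones-spread) (spread₀ zeros-spread)

      -- the permuted prefix normal supports a facet with vertex λ ∘ π
      prefix-at-distance-one : ∀ {p} → RelInt S p → FacetsAtDistanceOne S p →
        dot (prefix s) (asPoint lam) ≡ dot (prefix s) (λ i → p (π ⟨$⟩ˡ i)) + + 1
      prefix-at-distance-one {p} p-relint distance-one = begin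
        dot (prefix s) (asPoint lam)                   ≡⟨ sum-cong (λ i → cong (λ z → prefix s i * + lam z) (sym (Perm.inverseʳ π {i}))) ⟩
        dot (prefix s) (λ i → w₀ (π ⟨$⟩ˡ i))           ≡⟨ sym (dot-permuteˡ (prefix s) w₀ π) ⟩
        dot χ w₀                                       ≡⟨ facet-at-distance-one lam gap {p} p-relint distance-one {χ} {w₀} facet maximiser χx₁≡1 χx₀≡0 ⟩
        dot χ p + + 1                                  ≡⟨ cong (_+ + 1) (dot-permuteˡ (prefix s) p π) ⟩
        dot (prefix s) (λ i → p (π ⟨$⟩ˡ i)) + + 1 ∎
        where open ≡-Reasoning

    one pen : Fin n
    one = Fin.suc Fin.zero
    pen = Fin.inject₁ (Fin.fromℕ k)

    toℕ-pen : toℕ pen ≡ k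
    toℕ-pen = trans (FinP.toℕ-inject₁ (Fin.fromℕ k)) (FinP.toℕ-fromℕ k)

    module _ {T₁ T₂ : ℕ} (μ≡ : ∀ i → + μ i ≡ prefix T₁ i + prefix T₂ i) (T₁+T₂≡n : T₁ ℕ.+ T₂ ≡ n) where

      even-steps : T₁ ≡ T₂ → n % 2 ≡ 0 × μ ≗ fam3 n
      even-steps T₁≡T₂ = proj₁ halves , μ≗ λ i → begin
        + μ i                          ≡⟨ trans (μ≡ i) (cong (λ t → prefix t i + prefix T₂ i) T₁≡T₂) ⟩
        prefix T₂ i + prefix T₂ i      ≡⟨ double (prefix T₂ i) ⟩
        + 2 * prefix T₂ i              ≡⟨ cong (λ t → + 2 * prefix t i) (sym (proj₂ halves)) ⟩
        + 2 * prefix (n / 2) i         ≡⟨ sym (fam3-prefix n i) ⟩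
        + fam3 n i ∎
        where
        open ≡-Reasoning
        halves : n % 2 ≡ 0 × n / 2 ≡ T₂
        halves = halve-even (trans (sym T₁+T₂≡n) (cong (ℕ._+ T₂) T₁≡T₂))
        double : ∀ x → x + x ≡ + 2 * x
        double = solve-∀

      odd-steps : T₁ ≡ suc T₂ → n % 2 ≡ 1 × μ ≗ fam4 n
      odd-steps T₁≡T₂+1 = proj₁ halves , μ≗ λ i →
        trans (μ≡ i) (trans (cong₂ (λ t t′ → prefix t i + prefix t′ i) (trans T₁≡T₂+1 (cong suc (sym (proj₂ halves)))) (sym (proj₂ halves)))
                            (sym (fam4-prefix n i)))
        where
        halves : n % 2 ≡ 1 × n / 2 ≡ T₂
        halves = halve-odd (trans (sym T₁+T₂≡n) (cong (ℕ._+ T₂) T₁≡T₂+1))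

      single-two : T₂ ≡ 1 → μ ≗ fam2 n
      single-two T₂≡1 = μ≗ λ i →
        trans (μ≡ i) (trans (ℤP.+-comm (prefix T₁ i) (prefix T₂ i))
                     (trans (cong₂ (λ t t′ → prefix t i + prefix t′ i) T₂≡1 T₁≡k+1) (sym (fam2-prefix k i))))
        where
        T₁≡k+1 : T₁ ≡ suc k
        T₁≡k+1 = ℕP.suc-injective (trans (trans (ℕP.+-comm 1 T₁) (cong (T₁ ℕ.+_) (sym T₂≡1))) T₁+T₂≡n)

    module _ {p} (p-relint : RelInt S p) (distance-one : FacetsAtDistanceOne S p) where

      sum-centre : sumFinℤ n p ≡ N
      sum-centre = aff-sum lam {p} (conv⊆aff lam {p} (proj₁ p-relint))

      centre-below-top : k ≡ 0 ⊎ lam last ℕ.< lam one → ∀ i → p i + + 1 ≡ top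
      centre-below-top k≡0⊎λl<λ1 i = sym (begin
        top                                               ≡⟨ sym (dot-prefix-one (suc k) (asPoint lam)) ⟩
        dot (prefix 1) (asPoint lam)                      ≡⟨ prefix-at-distance-one τ 1 (ℕ.s≤s ℕ.z≤n) (ℕ.s≤s ℕ.z≤n) (inj₁ refl) (zeros-spread k≡0⊎λl<λ1) {p} p-relint distance-one ⟩
        dot (prefix 1) (λ l → p (τ ⟨$⟩ˡ l)) + + 1         ≡⟨ cong (_+ + 1) (trans (dot-prefix-one (suc k) (λ l → p (τ ⟨$⟩ˡ l))) (cong p (transpose-matchˡ Fin.zero i))) ⟩
        p i + + 1 ∎)
        where
        open ≡-Reasoning
        τ = Perm.transpose i Fin.zero
        zeros-spread : k ≡ 0 ⊎ lam last ℕ.< lam one → 1 ≡ suc k ⊎ ∃ λ b → 1 ℕ.≤ toℕ b × lam b ≢ lam last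
        zeros-spread (inj₁ k≡0)    = inj₁ (cong suc (sym k≡0))
        zeros-spread (inj₂ λl<λ1) = inj₂ (one , ℕ.s≤s ℕ.z≤n , λ λ1≡λl → ℕP.<-irrefl (sym λ1≡λl) λl<λ1)

      centre-above-bottom : k ≡ 0 ⊎ lam pen ℕ.< lam Fin.zero → ∀ j → p j ≡ bottom + + 1
      centre-above-bottom k≡0⊎λpen<λ0 j = begin
        p j                                     ≡⟨ isolate N (p j) ⟩
        N + + 1 - (N - p j + + 1)               ≡⟨ cong (λ z → N + + 1 - z) (sym distance) ⟩
        N + + 1 - (N - bottom)                  ≡⟨ cancel N bottom ⟩
        bottom + + 1 ∎
        where
        open ≡-Reasoning
        τ = Perm.transpose j last
        isolate : ∀ s x → x ≡ s + + 1 - (s - x + + 1)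
        isolate = solve-∀
        cancel : ∀ s b → s + + 1 - (s - b) ≡ b + + 1
        cancel = solve-∀
        ones-spread : k ≡ 0 ⊎ lam pen ℕ.< lam Fin.zero → suc k ≡ 1 ⊎ ∃ λ a → toℕ a ℕ.< suc k × lam a ≢ lam Fin.zero
        ones-spread (inj₁ k≡0)      = inj₁ (cong suc k≡0)
        ones-spread (inj₂ λpen<λ0) = inj₂ (pen , subst (ℕ._< suc k) (sym toℕ-pen) (ℕP.n<1+n k) , ℕP.<⇒≢ λpen<λ0)
        distance : N - bottom ≡ N - p j + + 1
        distance = begin
          N - bottom                                       ≡⟨ sym (dot-prefix-last (suc k) (asPoint lam)) ⟩
          dot (prefix (suc k)) (asPoint lam)
            ≡⟨ prefix-at-distance-one τ (suc k) (ℕ.s≤s ℕ.z≤n) ℕP.≤-refl (ones-spread k≡0⊎λpen<λ0) (inj₁ refl) {p} p-relint distance-one ⟩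
          dot (prefix (suc k)) (λ l → p (τ ⟨$⟩ˡ l)) + + 1  ≡⟨ cong (_+ + 1) (dot-prefix-last (suc k) (λ l → p (τ ⟨$⟩ˡ l))) ⟩
          sumFinℤ n (λ l → p (τ ⟨$⟩ˡ l)) - p (τ ⟨$⟩ˡ last) + + 1
            ≡⟨ cong₂ (λ x y → x - p y + + 1) (trans (sum-permute p (Perm.flip τ)) sum-centre) (transpose-matchˡ last j) ⟩
          N - p j + + 1 ∎

      private
        sum-μ : (∀ j → p j ≡ bottom + + 1) → sumFinℤ n (λ i → + μ i) ≡ + n
        sum-μ p≡ = begin
          Σμ                                ≡⟨ split (+ n) bottom Σμ ⟩
          + n * bottom + Σμ - + n * bottom  ≡⟨ cong (_- + n * bottom) (sym N≡) ⟩
          N - + n * bottom                  ≡⟨ cong (_- + n * bottom) (trans (sym sum-centre) (trans (sum-cong p≡) (sum-const n (bottom + + 1)))) ⟩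
          + n * (bottom + + 1) - + n * bottom ≡⟨ cancel (+ n) bottom ⟩
          + n ∎
          where
          open ≡-Reasoning
          Σμ = sumFinℤ n (λ i → + μ i)
          split : ∀ x b s → s ≡ x * b + s - x * b
          split = solve-∀
          cancel : ∀ x b → x * (b + + 1) - x * b ≡ x
          cancel = solve-∀

      -- λ = (c + e, …, c + e, c): the centre sits one below the top in every coordinate, which forces e = n
      top-heavy-case : lam pen ≡ lam Fin.zero → (k ≡ 0 ⊎ lam last ℕ.< lam one) → μ ≗ fam5 n
      top-heavy-case λpen≡λ0 k≡0⊎λl<λ1 =
        μ≗ λ i → trans (μ≡ i) (trans (cong (_* prefix (suc k) i) e≡n) (sym (fam5-prefix k i)))
        where
        e = μ Fin.zero
        μ≡ : ∀ i → + μ i ≡ + e * prefix (suc k) i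
        μ≡ i with toℕ i ℕ.<? suc k
        ... | yes i<k+1 rewrite prefix-< (suc k) i i<k+1 = trans (cong +_ (cong (ℕ._∸ lam last) λi≡λ0)) (sym (ℤP.*-identityʳ (+ e)))
          where
          λi≡λ0 : lam i ≡ lam Fin.zero
          λi≡λ0 = ℕP.≤-antisym (partition Fin.zero i ℕ.z≤n)
                               (subst (ℕ._≤ lam i) λpen≡λ0 (partition i pen (subst (toℕ i ℕ.≤_) (sym toℕ-pen) (ℕ.s≤s⁻¹ i<k+1))))
        ... | no  i≮k+1 rewrite prefix-≥ (suc k) i (ℕP.≮⇒≥ i≮k+1) = trans (cong +_ (trans (cong μ i≡last) μ-last)) (sym (ℤP.*-zeroʳ (+ e)))
          where
          i≡last : i ≡ last
          i≡last = FinP.toℕ-injective (ℕP.≤-antisym (FinP.≤fromℕ i) (subst (ℕ._≤ toℕ i) (sym (FinP.toℕ-fromℕ (suc k))) (ℕP.≮⇒≥ i≮k+1)))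
        n-equation : + n * (bottom + + e - + 1) ≡ + n * bottom + + e * + suc k
        n-equation = begin
          + n * (bottom + + e - + 1)                ≡⟨ cong (λ t → + n * (t - + 1)) (sym (lam≡ Fin.zero)) ⟩
          + n * (top - + 1)                         ≡⟨ sym (sum-const n (top - + 1)) ⟩
          sumFinℤ n (λ _ → top - + 1)               ≡⟨ sum-cong (λ i → sym (below-top i)) ⟩
          sumFinℤ n p                               ≡⟨ trans sum-centre N≡ ⟩
          + n * bottom + sumFinℤ n (λ i → + μ i)    ≡⟨ cong (λ s → + n * bottom + s) (trans (sum-cong μ≡) (trans (sum-*ˡ (+ e) (prefix {n} (suc k))) (cong (+ e *_) (sum-prefix n (suc k) (ℕP.n≤1+n (suc k)))))) ⟩
          + n * bottom + + e * + suc k ∎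
          where
          open ≡-Reasoning
          below-top : ∀ i → p i ≡ top - + 1
          below-top i = trans (isolate (p i)) (cong (_- + 1) (centre-below-top k≡0⊎λl<λ1 i))
            where
            isolate : ∀ x → x ≡ x + + 1 - + 1
            isolate = solve-∀
        e≡n : + e ≡ + n
        e≡n = begin
          + e                                                                       ≡⟨ solve-for (+ e) bottom (+ suc k) ⟩
          + n * (bottom + + e - + 1) - (+ n * bottom + + e * + suc k) + + n         ≡⟨ cong (_+ + n) (trans (cong₂ _-_ n-equation refl) (ℤP.+-inverseʳ (+ n * bottom + + e * + suc k))) ⟩
          + 0 + + n                                                                 ≡⟨ ℤP.+-identityˡ (+ n) ⟩
          + n ∎
          where
          open ≡-Reasoning
          solve-for : ∀ e b K → e ≡ (+ 1 + K) * (b + e - + 1) - ((+ 1 + K) * b + e * K) + (+ 1 + K)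
          solve-for = solve-∀

      -- λ = (c + e, c, …, c): the centre sits one above the bottom in every coordinate, which forces e = n
      bottom-heavy-case : lam one ≡ lam last → (k ≡ 0 ⊎ lam pen ℕ.< lam Fin.zero) → μ ≗ fam1 n
      bottom-heavy-case λ1≡λl k≡0⊎λpen<λ0 =
        μ≗ λ i → trans (μ≡ i) (trans (cong (_* prefix 1 i) e≡n) (sym (fam1-prefix n i)))
        where
        e = μ Fin.zero
        μ-suc : ∀ i → μ (Fin.suc i) ≡ 0
        μ-suc i = trans (cong (ℕ._∸ lam last) (ℕP.≤-antisym (subst (lam (Fin.suc i) ℕ.≤_) λ1≡λl (partition one (Fin.suc i) (ℕ.s≤s ℕ.z≤n)))
                                                            (partition (Fin.suc i) last (FinP.≤fromℕ _))))
                        (ℕP.n∸n≡0 (lam last))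
        μ≡ : ∀ i → + μ i ≡ + e * prefix 1 i
        μ≡ Fin.zero    = sym (ℤP.*-identityʳ (+ e))
        μ≡ (Fin.suc i) = trans (cong +_ (μ-suc i)) (sym (ℤP.*-zeroʳ (+ e)))
        e≡n : + e ≡ + n
        e≡n = begin
          + e                            ≡⟨ sym (ℤP.*-identityʳ (+ e)) ⟩
          + e * + 1                      ≡⟨ sym (trans (sum-cong μ≡) (trans (sum-*ˡ (+ e) (prefix {n} 1)) (cong (+ e *_) (sum-prefix n 1 (ℕ.s≤s ℕ.z≤n))))) ⟩
          sumFinℤ n (λ i → + μ i)        ≡⟨ sum-μ (centre-above-bottom k≡0⊎λpen<λ0) ⟩
          + n ∎
          where open ≡-Reasoning

      private
        TwoSteps : Set
        TwoSteps = Σ ℕ λ T₁ → Σ ℕ λ T₂ → (∀ i → + μ i ≡ prefix T₁ i + prefix T₂ i) ×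
                   T₁ ℕ.+ T₂ ≡ n × 1 ℕ.≤ T₂ × T₂ ℕ.≤ T₁ × T₁ ℕ.≤ suc k

      -- here top = bottom + 2, so μ takes the values 2, 1, 0 on consecutive blocks of lengths T₂, T₁ - T₂, n - T₁
      two-steps : (k ≡ 0 ⊎ lam last ℕ.< lam one) → (k ≡ 0 ⊎ lam pen ℕ.< lam Fin.zero) → TwoSteps
      two-steps k≡0⊎λl<λ1 k≡0⊎λpen<λ0 with threshold μ-partition 1 | threshold μ-partition 2
      ... | T₁ , T₁≤n , ≥1⇒<T₁ , <T₁⇒≥1 | T₂ , T₂≤n , ≥2⇒<T₂ , <T₂⇒≥2 = T₁ , T₂ , μ≡ , T₁+T₂≡n , 1≤T₂ , T₂≤T₁ , T₁≤k+1
        where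
        λ0≡ : lam Fin.zero ≡ lam last ℕ.+ 1 ℕ.+ 1
        λ0≡ = ℤP.+-injective (trans (sym (centre-below-top k≡0⊎λl<λ1 Fin.zero))
                                    (cong (_+ + 1) (centre-above-bottom k≡0⊎λpen<λ0 Fin.zero)))
        μ0≡2 : μ Fin.zero ≡ 2
        μ0≡2 = trans (cong (ℕ._∸ lam last) (trans λ0≡ (ℕP.+-assoc (lam last) 1 1))) (ℕP.m+n∸m≡n (lam last) 2)
        μ≤2 : ∀ i → μ i ℕ.≤ 2
        μ≤2 i = subst (μ i ℕ.≤_) μ0≡2 (μ-partition Fin.zero i ℕ.z≤n)
        μ≡ : ∀ i → + μ i ≡ prefix T₁ i + prefix T₂ i
        μ≡ i with toℕ i ℕ.<? T₁ | toℕ i ℕ.<? T₂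
        ... | yes i<T₁ | yes i<T₂ rewrite prefix-< T₁ i i<T₁ | prefix-< T₂ i i<T₂ =
          cong +_ (ℕP.≤-antisym (μ≤2 i) (<T₂⇒≥2 i i<T₂))
        ... | yes i<T₁ | no  i≮T₂ rewrite prefix-< T₁ i i<T₁ | prefix-≥ T₂ i (ℕP.≮⇒≥ i≮T₂) =
          cong +_ (ℕP.≤-antisym (ℕ.s≤s⁻¹ (ℕP.≰⇒> (i≮T₂ ∘ ≥2⇒<T₂ i))) (<T₁⇒≥1 i i<T₁))
        ... | no  i≮T₁ | yes i<T₂ = ⊥-elim (i≮T₁ (≥1⇒<T₁ i (ℕP.≤-trans (ℕ.s≤s ℕ.z≤n) (<T₂⇒≥2 i i<T₂))))
        ... | no  i≮T₁ | no  i≮T₂ rewrite prefix-≥ T₁ i (ℕP.≮⇒≥ i≮T₁) | prefix-≥ T₂ i (ℕP.≮⇒≥ i≮T₂) =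
          cong +_ (ℕP.n<1⇒n≡0 (ℕP.≰⇒> (i≮T₁ ∘ ≥1⇒<T₁ i)))
        T₁+T₂≡n : T₁ ℕ.+ T₂ ≡ n
        T₁+T₂≡n = ℤP.+-injective (begin
          + T₁ + + T₂                                    ≡⟨ sym (cong₂ _+_ (sum-prefix n T₁ T₁≤n) (sum-prefix n T₂ T₂≤n)) ⟩
          sumFinℤ n (prefix T₁) + sumFinℤ n (prefix T₂)  ≡⟨ sym (trans (sum-cong μ≡) (sum-+ (prefix {n} T₁) (prefix T₂))) ⟩
          sumFinℤ n (λ i → + μ i)                        ≡⟨ sum-μ (centre-above-bottom k≡0⊎λpen<λ0) ⟩
          + n ∎)
          where open ≡-Reasoning
        1≤T₂ : 1 ℕ.≤ T₂
        1≤T₂ = ≥2⇒<T₂ Fin.zero (ℕP.≤-reflexive (sym μ0≡2))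
        T₂≤T₁ : T₂ ℕ.≤ T₁
        T₂≤T₁ with T₂ ℕ.≤? T₁
        ... | yes T₂≤T₁ = T₂≤T₁
        ... | no  T₂≰T₁ = ⊥-elim (ℕP.<-irrefl (FinP.toℕ-fromℕ< T₁<n) (≥1⇒<T₁ _ (ℕP.≤-trans (ℕ.s≤s ℕ.z≤n) (<T₂⇒≥2 _ T₁<T₂))))
          where
          T₁<n : T₁ ℕ.< n
          T₁<n = ℕP.<-≤-trans (ℕP.≰⇒> T₂≰T₁) T₂≤n
          T₁<T₂ : toℕ (Fin.fromℕ< T₁<n) ℕ.< T₂
          T₁<T₂ = subst (ℕ._< T₂) (sym (FinP.toℕ-fromℕ< T₁<n)) (ℕP.≰⇒> T₂≰T₁)
        T₁≤k+1 : T₁ ℕ.≤ suc k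
        T₁≤k+1 with T₁ ℕ.≤? suc k
        ... | yes T₁≤k+1 = T₁≤k+1
        ... | no  T₁≰k+1 = ⊥-elim (ℕP.<-irrefl (sym μ-last) (<T₁⇒≥1 last (subst (ℕ._< T₁) (sym (FinP.toℕ-fromℕ (suc k))) (ℕP.≰⇒> T₁≰k+1))))

      -- with two middle entries equal to 1, the prefix facet ending just after the 2s is at distance T₂ from the centre
      no-long-middle : ∀ {T₁ T₂} → (∀ i → + μ i ≡ prefix T₁ i + prefix T₂ i) → T₁ ℕ.≤ suc k →
        (∀ j → p j ≡ bottom + + 1) → 2 ℕ.≤ T₂ → suc (suc T₂) ℕ.≤ T₁ → ⊥
      no-long-middle {T₁} {T₂} μ≡ T₁≤k+1 p≡ 2≤T₂ T₂+2≤T₁ = ℕP.<-irrefl (sym T₂≡1) 2≤T₂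
        where
        s = suc T₂
        s<n : s ℕ.< n
        s<n = ℕP.<-≤-trans (ℕP.<-≤-trans (ℕP.n<1+n s) T₂+2≤T₁) (ℕP.≤-trans T₁≤k+1 (ℕP.n≤1+n (suc k)))
        T₂<n : T₂ ℕ.< n
        T₂<n = ℕP.<-trans (ℕP.n<1+n T₂) s<n
        a b : Fin n
        a = Fin.fromℕ< T₂<n
        b = Fin.fromℕ< s<n
        toℕ-a : toℕ a ≡ T₂
        toℕ-a = FinP.toℕ-fromℕ< T₂<n
        toℕ-b : toℕ b ≡ s
        toℕ-b = FinP.toℕ-fromℕ< s<n
        μa : + μ a ≡ + 1 + + 0
        μa = trans (μ≡ a) (cong₂ _+_ (prefix-< T₁ a (subst (ℕ._< T₁) (sym toℕ-a) (ℕP.<-trans (ℕP.n<1+n T₂) T₂+2≤T₁)))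
                                    (prefix-≥ T₂ a (ℕP.≤-reflexive (sym toℕ-a))))
        μb : + μ b ≡ + 1 + + 0
        μb = trans (μ≡ b) (cong₂ _+_ (prefix-< T₁ b (subst (ℕ._< T₁) (sym toℕ-b) T₂+2≤T₁))
                                    (prefix-≥ T₂ b (subst (T₂ ℕ.≤_) (sym toℕ-b) (ℕP.n≤1+n T₂))))
        μ0 : + μ Fin.zero ≡ + 1 + + 1
        μ0 = trans (μ≡ Fin.zero) (cong₂ _+_ (prefix-< {n} T₁ Fin.zero (ℕP.<-≤-trans (ℕ.s≤s ℕ.z≤n) T₂+2≤T₁))
                                            (prefix-< {n} T₂ Fin.zero (ℕP.≤-trans (ℕ.s≤s ℕ.z≤n) 2≤T₂)))
        λa≢λ0 : lam a ≢ lam Fin.zero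
        λa≢λ0 λa≡λ0 with trans (sym μa) (trans (cong (λ z → + (z ℕ.∸ lam last)) λa≡λ0) μ0)
        ... | ()
        λb≢λl : lam b ≢ lam last
        λb≢λl λb≡λl with trans (sym μb) (trans (cong (λ z → + (z ℕ.∸ lam last)) λb≡λl) (cong +_ μ-last))
        ... | ()
        distance : dot (prefix s) (asPoint lam) ≡ dot (prefix s) p + + 1
        distance = prefix-at-distance-one Perm.id s (ℕ.s≤s ℕ.z≤n) (ℕP.<⇒≤ (ℕP.<-≤-trans (ℕP.n<1+n s) (ℕP.≤-trans T₂+2≤T₁ T₁≤k+1)))
                     (inj₂ (a , subst (ℕ._< s) (sym toℕ-a) ℕP.≤-refl , λa≢λ0))
                     (inj₂ (b , ℕP.≤-reflexive (sym toℕ-b) , λb≢λl)) {p} p-relint distance-one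
        ∑s : sumFinℤ n (prefix {n} s) ≡ + s
        ∑s = sum-prefix n s (ℕP.<⇒≤ s<n)
        dot-λ : dot (prefix s) (asPoint lam) ≡ bottom * + s + (+ s + + T₂)
        dot-λ = begin
          dot (prefix s) (asPoint lam)
            ≡⟨ sum-cong (λ i → trans (cong (prefix s i *_) (trans (lam≡ i) (cong (λ z → bottom + z) (μ≡ i)))) (pointwise i)) ⟩
          sumFinℤ n (λ i → bottom * prefix s i + (prefix s i + prefix T₂ i))
            ≡⟨ trans (sum-+ {n} (λ i → bottom * prefix s i) (λ i → prefix s i + prefix T₂ i))
                     (cong₂ _+_ (trans (sum-*ˡ bottom (prefix {n} s)) (cong (bottom *_) ∑s))
                                (trans (sum-+ (prefix {n} s) (prefix T₂)) (cong₂ _+_ ∑s (sum-prefix n T₂ (ℕP.<⇒≤ T₂<n))))) ⟩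
          bottom * + s + (+ s + + T₂) ∎
          where
          open ≡-Reasoning
          pointwise : ∀ i → prefix s i * (bottom + (prefix T₁ i + prefix T₂ i)) ≡ bottom * prefix s i + (prefix s i + prefix T₂ i)
          pointwise i = trans (expand bottom (prefix s i) (prefix T₁ i) (prefix T₂ i))
            (cong₂ (λ x y → bottom * prefix s i + (x + y)) (prefix-*-prefix (ℕP.<⇒≤ (ℕP.<-≤-trans (ℕP.n<1+n s) T₂+2≤T₁)) i)
                                                             (prefix-*-prefix (ℕP.n≤1+n T₂) i))
            where
            expand : ∀ c x y z → x * (c + (y + z)) ≡ c * x + (x * y + z * x)
            expand = solve-∀
        dot-p : dot (prefix s) p ≡ (bottom + + 1) * + s
        dot-p = trans (sum-cong (λ i → trans (cong (prefix s i *_) (p≡ i)) (ℤP.*-comm (prefix s i) (bottom + + 1))))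
                      (trans (sum-*ˡ (bottom + + 1) (prefix {n} s)) (cong ((bottom + + 1) *_) ∑s))
        T₂≡1 : T₂ ≡ 1
        T₂≡1 = ℤP.+-injective (begin
          + T₂                                                 ≡⟨ isolate bottom (+ s) (+ T₂) ⟩
          bottom * + s + (+ s + + T₂) - (bottom + + 1) * + s   ≡⟨ cong₂ _-_ (trans (sym dot-λ) (trans distance (cong (_+ + 1) dot-p))) refl ⟩
          (bottom + + 1) * + s + + 1 - (bottom + + 1) * + s    ≡⟨ cancel ((bottom + + 1) * + s) ⟩
          + 1 ∎)
          where
          open ≡-Reasoning
          isolate : ∀ c s t → t ≡ c * s + (s + t) - (c + + 1) * s
          isolate = solve-∀
          cancel : ∀ x → x + + 1 - x ≡ + 1
          cancel = solve-∀

      two-steps-case : (k ≡ 0 ⊎ lam last ℕ.< lam one) → (k ≡ 0 ⊎ lam pen ℕ.< lam Fin.zero) → InList n μ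
      two-steps-case k≡0⊎λl<λ1 k≡0⊎λpen<λ0 = classify (two-steps k≡0⊎λl<λ1 k≡0⊎λpen<λ0)
        where
        classify : TwoSteps → InList n μ
        classify (T₁ , T₂ , μ≡ , T₁+T₂≡n , 1≤T₂ , T₂≤T₁ , T₁≤k+1) = decide (T₁ ℕ.≟ T₂) (T₁ ℕ.≟ suc T₂) (T₂ ℕ.≟ 1)
          where
          decide : Dec (T₁ ≡ T₂) → Dec (T₁ ≡ suc T₂) → Dec (T₂ ≡ 1) → InList n μ
          decide (yes T₁≡T₂) _                 _          = inj₂ (inj₂ (inj₁ (even-steps μ≡ T₁+T₂≡n T₁≡T₂)))
          decide (no  _)     (yes T₁≡T₂+1)    _          = inj₂ (inj₂ (inj₂ (inj₁ (odd-steps μ≡ T₁+T₂≡n T₁≡T₂+1))))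
          decide (no  _)     (no  _)          (yes T₂≡1) = inj₂ (inj₁ (single-two μ≡ T₁+T₂≡n T₂≡1))
          decide (no  T₁≢T₂) (no  T₁≢T₂+1)    (no  T₂≢1) =
            ⊥-elim (no-long-middle μ≡ T₁≤k+1 (centre-above-bottom k≡0⊎λpen<λ0) (ℕP.≤∧≢⇒< 1≤T₂ (T₂≢1 ∘ sym))
                                   (ℕP.≤∧≢⇒< (ℕP.≤∧≢⇒< T₂≤T₁ (T₁≢T₂ ∘ sym)) (T₁≢T₂+1 ∘ sym)))

    necessity : Reflexive S → InList n μ
    necessity (p , p-relint , distance-one) = decide (lam pen ℕ.≟ lam Fin.zero) (lam last ℕ.<? lam one)
      where
      decide : Dec (lam pen ≡ lam Fin.zero) → Dec (lam last ℕ.< lam one) → InList n μ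
      decide (yes λpen≡λ0) _ = inj₂ (inj₂ (inj₂ (inj₂ (top-heavy-case {p} p-relint distance-one λpen≡λ0 k≡0⊎λl<λ1))))
        where
        k≡0⊎λl<λ1 : k ≡ 0 ⊎ lam last ℕ.< lam one
        k≡0⊎λl<λ1 with k ℕ.≟ 0
        ... | yes k≡0 = inj₁ k≡0
        ... | no  k≢0 = inj₂ (ℕP.<-≤-trans gap (subst (ℕ._≤ lam one) λpen≡λ0
                                                   (partition one pen (subst (1 ℕ.≤_) (sym toℕ-pen) (ℕP.n≢0⇒n>0 k≢0)))))
      decide (no λpen≢λ0) (yes λl<λ1) = two-steps-case {p} p-relint distance-one (inj₂ λl<λ1) (inj₂ λpen<λ0)
        where
        λpen<λ0 : lam pen ℕ.< lam Fin.zero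
        λpen<λ0 = ℕP.≤∧≢⇒< (partition Fin.zero pen ℕ.z≤n) λpen≢λ0
      decide (no λpen≢λ0) (no λl≮λ1) = inj₁ (bottom-heavy-case {p} p-relint distance-one λ1≡λl (inj₂ λpen<λ0))
        where
        λpen<λ0 : lam pen ℕ.< lam Fin.zero
        λpen<λ0 = ℕP.≤∧≢⇒< (partition Fin.zero pen ℕ.z≤n) λpen≢λ0
        λ1≡λl : lam one ≡ lam last
        λ1≡λl = ℕP.≤-antisym (ℕP.≮⇒≥ λl≮λ1) (partition one last (FinP.≤fromℕ one))

  module Sufficiency {k : ℕ} (lam : Fin (suc (suc k)) → ℕ) (partition : IsPartition lam)
                     (gap : lam (Fin.fromℕ (suc k)) ℕ.< lam Fin.zero) where

    open Facets lam gap
    open Bounds lam partition gap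

    proper-binary-sizes : ∀ {χ} → Binary χ → ProperFace S χ → + 1 ≤ sumFinℤ n χ × + 1 ≤ + n - sumFinℤ n χ
    proper-binary-sizes {χ} χ-bin (w₁ , w₂ , Sw₁ , Sw₂ , w₁<w₂) = ones , zeros
      where
      level : (∀ {w} → S w → dot χ w ≡ dot χ w₁) → ⊥
      level constant = ℤP.<-irrefl (sym (constant Sw₂)) w₁<w₂
      ones : + 1 ≤ sumFinℤ n χ
      ones with FinP.any? (λ i → χ i ℤ.≟ + 1)
      ... | yes (i , χi≡1) = binary-1≤sum χ-bin i χi≡1
      ... | no  no-one = ⊥-elim (level λ {w} _ → trans (vanishes w) (sym (vanishes w₁)))
        where
        vanishes : ∀ w → dot χ w ≡ + 0
        vanishes w = sum-zero (λ l → χ l * w l) (λ l → cong (_* w l) (binary-≢1 χ-bin l (λ χl≡1 → no-one (l , χl≡1))))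
      zeros : + 1 ≤ + n - sumFinℤ n χ
      zeros with FinP.any? (λ i → χ i ℤ.≟ + 0)
      ... | yes (j , χj≡0) = subst (+ 1 ≤_) (sum-complement χ) (binary-1≤sum (complement-binary χ-bin) j (cong (λ z → + 1 - z) χj≡0))
      ... | no  no-zero = ⊥-elim (level λ {w} Sw → trans (total Sw) (sym (total Sw₁)))
        where
        total : ∀ {w} → S w → dot χ w ≡ N
        total {w} Sw = trans (sum-cong (λ l → trans (cong (_* w l) (binary-≢0 χ-bin l (λ χl≡0 → no-zero (l , χl≡0)))) (ℤP.*-identityˡ (w l))))
                             (orbit-sum lam Sw)

    -- a binary facet normal with s ones is bounded via the top value when s ≤ 1 and via the bottom value
    -- when n - s ≤ 1; beyond that the facet lemmas on multiplicities rule it out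
    SideBounds : ℤ → Set
    SideBounds d = ∀ s → + 1 ≤ s → + 1 ≤ + n - s →
      (+ 2 ≤ s → multiplicity top < s) → (+ 2 ≤ + n - s → multiplicity bottom < + n - s) →
      top * s ≤ d * s + + 1 ⊎ N - bottom * (+ n - s) ≤ d * s + + 1

    reflexive-if-sides : ∀ d → N ≡ + n * d → SideBounds d → Reflexive S
    reflexive-if-sides d N≡nd sides = reflexive-if-bounded lam gap d N≡nd bound
      where
      bound : ∀ {χ v} → Binary χ → Facet S χ → MaxAt S χ v → dot χ v ≤ d * sumFinℤ n χ + + 1
      bound {χ} {v} χ-bin χ-facet v-max
        with sides (sumFinℤ n χ) (proj₁ sizes) (proj₂ sizes) (facet-ones-exceed-top χ-bin χ-facet v-max)
                   (λ 2≤ → subst (multiplicity bottom <_) (sum-complement χ)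
                                 (facet-zeros-exceed-bottom χ-bin χ-facet v-max (subst (+ 2 ≤_) (sym (sum-complement χ)) 2≤)))
        where
        sizes = proper-binary-sizes χ-bin (proj₁ χ-facet)
      ... | inj₁ top-side    = ℤP.≤-trans (dot-≤-top χ-bin (proj₁ v-max)) top-side
      ... | inj₂ bottom-side = ℤP.≤-trans (subst (λ z → dot χ v ≤ N - bottom * z) (sum-complement χ) (dot-≤-bottom χ-bin (proj₁ v-max))) bottom-side

    top-side : ∀ {d s} → top ≡ d + + 1 → s ≤ + 1 → top * s ≤ d * s + + 1
    top-side {d} {s} top≡ s≤1 = ℤP.0≤i-j⇒j≤i (subst (+ 0 ≤_) slack (ℤP.i≤j⇒0≤j-i s≤1))
      where
      identity : ∀ d s → + 1 - s ≡ d * s + + 1 - (d + + 1) * s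
      identity = solve-∀
      slack : + 1 - s ≡ d * s + + 1 - top * s
      slack = trans (identity d s) (cong (λ t → d * s + + 1 - t * s) (sym top≡))

    bottom-side : ∀ {s} → N ≡ + n * (bottom + + 1) → + n - s ≤ + 1 → N - bottom * (+ n - s) ≤ (bottom + + 1) * s + + 1
    bottom-side {s} N≡ n-s≤1 = ℤP.0≤i-j⇒j≤i (subst (+ 0 ≤_) slack (ℤP.i≤j⇒0≤j-i n-s≤1))
      where
      identity : ∀ n b s → + 1 - (n - s) ≡ (b + + 1) * s + + 1 - (n * (b + + 1) - b * (n - s))
      identity = solve-∀
      slack : + 1 - (+ n - s) ≡ (bottom + + 1) * s + + 1 - (N - bottom * (+ n - s))
      slack = trans (identity (+ n) bottom s) (cong (λ t → (bottom + + 1) * s + + 1 - (t - bottom * (+ n - s))) (sym N≡))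

    ≤1⊎2≤ : ∀ x → x ≤ + 1 ⊎ + 2 ≤ x
    ≤1⊎2≤ x with x ℤ.≤? + 1
    ... | yes x≤1 = inj₁ x≤1
    ... | no  x≰1 = inj₂ (ℤP.i<j⇒suc[i]≤j (ℤP.≰⇒> x≰1))

    module _ {f : Point n} (μ≡f : ∀ i → + μ i ≡ f i) where

      lam≡f : ∀ i → + lam i ≡ bottom + f i
      lam≡f i = trans (lam≡ i) (cong (λ z → bottom + z) (μ≡f i))

      N≡f : N ≡ + n * bottom + sumFinℤ n f
      N≡f = trans N≡ (cong (λ z → + n * bottom + z) (sum-cong μ≡f))

      multiplicity-≥ : ∀ {ι t} → Binary ι → (∀ j → ι j ≡ + 1 → f j ≡ t) → sumFinℤ n ι ≤ multiplicity (bottom + t)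
      multiplicity-≥ ι-bin ι⇒t = binary-≤-multiplicity ι-bin λ j ιj≡1 → trans (lam≡f j) (cong (λ z → bottom + z) (ι⇒t j ιj≡1))

      top≡f : top ≡ bottom + f Fin.zero
      top≡f = lam≡f Fin.zero

    fam1-reflexive : μ ≗ fam1 n → Reflexive S
    fam1-reflexive μ≗ = reflexive-if-sides (bottom + + 1) N≡n[b+1] sides
      where
      f : Point n
      f i = + n * prefix 1 i
      μ≡f : ∀ i → + μ i ≡ f i
      μ≡f i = trans (cong +_ (μ≗ i)) (fam1-prefix n i)
      N≡n[b+1] : N ≡ + n * (bottom + + 1)
      N≡n[b+1] = begin
        N                                  ≡⟨ N≡f μ≡f ⟩
        + n * bottom + sumFinℤ n f         ≡⟨ cong (λ z → + n * bottom + z) (trans (sum-*ˡ (+ n) (prefix {n} 1)) (cong (+ n *_) (sum-prefix n 1 (ℕ.s≤s ℕ.z≤n)))) ⟩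
        + n * bottom + + n * + 1           ≡⟨ sym (ℤP.*-distribˡ-+ (+ n) bottom (+ 1)) ⟩
        + n * (bottom + + 1) ∎
        where open ≡-Reasoning
      n-1≤mult : + n - + 1 ≤ multiplicity bottom
      n-1≤mult = subst₂ _≤_ (trans (sum-complement (prefix {n} 1)) (cong (λ z → + n - z) (sum-prefix n 1 (ℕ.s≤s ℕ.z≤n))))
                            (cong multiplicity (ℤP.+-identityʳ bottom))
                            (multiplicity-≥ μ≡f (complement-binary (prefix-binary 1)) λ j ιj≡1 →
                               trans (cong (+ n *_) (complement-one (prefix-binary 1) {j} ιj≡1)) (ℤP.*-zeroʳ (+ n)))
      sides : SideBounds (bottom + + 1)
      sides s 1≤s _ _ few-bottoms with ≤1⊎2≤ (+ n - s)
      ... | inj₁ n-s≤1 = inj₂ (bottom-side N≡n[b+1] n-s≤1)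
      ... | inj₂ 2≤n-s = ⊥-elim (ℤP.<-irrefl refl (ℤP.≤-<-trans n-1≤mult (ℤP.<-≤-trans (few-bottoms 2≤n-s) n-s≤n-1)))
        where
        n-s≤n-1 : + n - s ≤ + n - + 1
        n-s≤n-1 = ℤP.+-monoʳ-≤ (+ n) (ℤP.neg-mono-≤ 1≤s)

    fam5-reflexive : μ ≗ fam5 n → Reflexive S
    fam5-reflexive μ≗ = reflexive-if-sides d N≡nd sides
      where
      d = bottom + + suc k
      f : Point n
      f i = + n * prefix (suc k) i
      μ≡f : ∀ i → + μ i ≡ f i
      μ≡f i = trans (cong +_ (μ≗ i)) (fam5-prefix k i)
      ∑prefix : sumFinℤ n (prefix {n} (suc k)) ≡ + suc k
      ∑prefix = sum-prefix n (suc k) (ℕP.n≤1+n (suc k))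
      N≡nd : N ≡ + n * d
      N≡nd = begin
        N                                  ≡⟨ N≡f μ≡f ⟩
        + n * bottom + sumFinℤ n f         ≡⟨ cong (λ z → + n * bottom + z) (trans (sum-*ˡ (+ n) (prefix {n} (suc k))) (cong (+ n *_) ∑prefix)) ⟩
        + n * bottom + + n * + suc k       ≡⟨ sym (ℤP.*-distribˡ-+ (+ n) bottom (+ suc k)) ⟩
        + n * d ∎
        where open ≡-Reasoning
      top≡d+1 : top ≡ d + + 1
      top≡d+1 = begin
        top                        ≡⟨ top≡f μ≡f ⟩
        bottom + + n * + 1         ≡⟨ cong (λ z → bottom + z) (trans (ℤP.*-identityʳ (+ n)) (cong +_ (ℕP.+-comm 1 (suc k)))) ⟩
        bottom + (+ suc k + + 1)   ≡⟨ sym (ℤP.+-assoc bottom (+ suc k) (+ 1)) ⟩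
        d + + 1 ∎
        where open ≡-Reasoning
      k+1≤mult : + suc k ≤ multiplicity top
      k+1≤mult = subst₂ _≤_ ∑prefix (cong multiplicity (sym (top≡f μ≡f)))
                   (multiplicity-≥ μ≡f (prefix-binary (suc k)) λ j ιj≡1 → cong (+ n *_) (trans ιj≡1 (sym (prefix-< {n} (suc k) Fin.zero (ℕ.s≤s ℕ.z≤n)))))
      sides : SideBounds d
      sides s _ 1≤n-s few-tops _ with ≤1⊎2≤ s
      ... | inj₁ s≤1 = inj₁ (top-side {d} top≡d+1 s≤1)
      ... | inj₂ 2≤s = ⊥-elim (ℤP.<-irrefl refl (ℤP.≤-<-trans k+1≤mult (ℤP.<-≤-trans (few-tops 2≤s) s≤k+1)))
        where
        s≤k+1 : s ≤ + suc k
        s≤k+1 = ℤP.0≤i-j⇒j≤i (subst (+ 0 ≤_) (shift (+ suc k) s) (ℤP.i≤j⇒0≤j-i 1≤n-s))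
          where
          shift : ∀ K s → (+ 1 + K) - s - + 1 ≡ K - s
          shift = solve-∀

    -- μ with values in {0, 1, 2} and as many 2s as 0s (up to one 1): a facet with s ones and n - s zeros,
    -- 2 ≤ s ≤ n - 2, would need more than q twos and more than r zeros
    balanced-reflexive : ∀ {q r} → N ≡ + n * (bottom + + 1) → top ≡ bottom + + 2 →
      + q ≤ multiplicity top → + r ≤ multiplicity bottom → n ℕ.≤ q ℕ.+ r ℕ.+ 1 → Reflexive S
    balanced-reflexive {q} {r} N≡n[b+1] top≡b+2 q≤mult r≤mult n≤q+r+1 = reflexive-if-sides (bottom + + 1) N≡n[b+1] sides
      where
      sides : SideBounds (bottom + + 1)
      sides s _ _ few-tops few-bottoms with ≤1⊎2≤ s | ≤1⊎2≤ (+ n - s)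
      ... | inj₁ s≤1 | _           = inj₁ (top-side {bottom + + 1} (trans top≡b+2 (sym (ℤP.+-assoc bottom (+ 1) (+ 1)))) s≤1)
      ... | inj₂ _   | inj₁ n-s≤1 = inj₂ (bottom-side N≡n[b+1] n-s≤1)
      ... | inj₂ 2≤s | inj₂ 2≤n-s = ⊥-elim (ℤP.<-irrefl refl (ℤP.≤-<-trans (ℤ.+≤+ n≤q+r+1) (ℤP.<-≤-trans (<-+1 _) too-many)))
        where
        too-many : + q + + r + + 1 + + 1 ≤ + n
        too-many = subst₂ _≤_ (regroup (+ q) (+ r)) (cancel s (+ n))
                     (ℤP.+-mono-≤ (<⇒+1≤ (ℤP.≤-<-trans q≤mult (few-tops 2≤s))) (<⇒+1≤ (ℤP.≤-<-trans r≤mult (few-bottoms 2≤n-s))))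
          where
          regroup : ∀ a b → a + + 1 + (b + + 1) ≡ a + b + + 1 + + 1
          regroup = solve-∀
          cancel : ∀ s n → s + (n - s) ≡ n
          cancel = solve-∀

    fam3-reflexive : n % 2 ≡ 0 → μ ≗ fam3 n → Reflexive S
    fam3-reflexive n%2≡0 μ≗ = balanced-reflexive {q} {q} N≡n[b+1] top≡b+2 q≤tops q≤bottoms (ℕP.≤-trans (ℕP.≤-reflexive n≡) (ℕP.m≤m+n (q ℕ.+ q) 1))
      where
      q = n / 2
      n≡ : n ≡ q ℕ.+ q
      n≡ = halves-even n n%2≡0
      0<q : 0 ℕ.< q
      0<q with q | n≡
      ... | zero  | ()
      ... | suc _ | _ = ℕ.s≤s ℕ.z≤n
      f : Point n
      f i = + 2 * prefix q i
      μ≡f : ∀ i → + μ i ≡ f i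
      μ≡f i = trans (cong +_ (μ≗ i)) (fam3-prefix n i)
      ∑q : sumFinℤ n (prefix {n} q) ≡ + q
      ∑q = sum-prefix n q (subst (q ℕ.≤_) (sym n≡) (ℕP.m≤m+n q q))
      N≡n[b+1] : N ≡ + n * (bottom + + 1)
      N≡n[b+1] = begin
        N                                   ≡⟨ N≡f μ≡f ⟩
        + n * bottom + sumFinℤ n f          ≡⟨ cong (λ z → + n * bottom + z) (trans (sum-*ˡ (+ 2) (prefix {n} q)) (cong (+ 2 *_) ∑q)) ⟩
        + n * bottom + + 2 * + q            ≡⟨ cong (λ z → + n * bottom + z) (trans (sym (ℤP.pos-* 2 q)) (cong +_ (trans (ℕP.*-comm 2 q) (trans (sym (+-self≡*2 q)) (sym n≡))))) ⟩
        + n * bottom + + n                  ≡⟨ cong (λ z → + n * bottom + z) (sym (ℤP.*-identityʳ (+ n))) ⟩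
        + n * bottom + + n * + 1            ≡⟨ sym (ℤP.*-distribˡ-+ (+ n) bottom (+ 1)) ⟩
        + n * (bottom + + 1) ∎
        where open ≡-Reasoning
      top≡b+2 : top ≡ bottom + + 2
      top≡b+2 = trans (top≡f μ≡f) (cong (λ z → bottom + + 2 * z) (prefix-< {n} q Fin.zero 0<q))
      q≤tops : + q ≤ multiplicity top
      q≤tops = subst₂ _≤_ ∑q (cong multiplicity (sym top≡b+2))
                 (multiplicity-≥ μ≡f (prefix-binary q) λ j ιj≡1 → cong (+ 2 *_) ιj≡1)
      q≤bottoms : + q ≤ multiplicity bottom
      q≤bottoms = subst₂ _≤_ ∑q̅ (cong multiplicity (ℤP.+-identityʳ bottom))
                    (multiplicity-≥ μ≡f (complement-binary (prefix-binary q)) λ j ιj≡1 →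
                       cong (+ 2 *_) (complement-one (prefix-binary q) {j} ιj≡1))
        where
        ∑q̅ : sumFinℤ n (complement (prefix q)) ≡ + q
        ∑q̅ = trans (sum-complement (prefix {n} q)) (trans (cong₂ (λ a b → + a - b) n≡ ∑q) (cancel (+ q)))
          where
          cancel : ∀ x → x + x - x ≡ x
          cancel = solve-∀

    fam4-reflexive : n % 2 ≡ 1 → μ ≗ fam4 n → Reflexive S
    fam4-reflexive n%2≡1 μ≗ = balanced-reflexive {q} {q} N≡n[b+1] top≡b+2 q≤tops q≤bottoms n≤
      where
      q = n / 2
      n≡ : n ≡ suc (q ℕ.+ q)
      n≡ = halves-odd n n%2≡1
      n≤ : n ℕ.≤ q ℕ.+ q ℕ.+ 1
      n≤ = ℕP.≤-reflexive (trans n≡ (ℕP.+-comm 1 (q ℕ.+ q)))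
      0<q : 0 ℕ.< q
      0<q with q | n≡
      ... | zero  | ()
      ... | suc _ | _ = ℕ.s≤s ℕ.z≤n
      q+1≤n : suc q ℕ.≤ n
      q+1≤n = subst (suc q ℕ.≤_) (sym n≡) (ℕ.s≤s (ℕP.m≤m+n q q))
      f : Point n
      f i = prefix (suc q) i + prefix q i
      μ≡f : ∀ i → + μ i ≡ f i
      μ≡f i = trans (cong +_ (μ≗ i)) (fam4-prefix n i)
      ∑q : sumFinℤ n (prefix {n} q) ≡ + q
      ∑q = sum-prefix n q (ℕP.≤-trans (ℕP.n≤1+n q) q+1≤n)
      ∑q+1 : sumFinℤ n (prefix {n} (suc q)) ≡ + suc q
      ∑q+1 = sum-prefix n (suc q) q+1≤n
      N≡n[b+1] : N ≡ + n * (bottom + + 1)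
      N≡n[b+1] = begin
        N                                   ≡⟨ N≡f μ≡f ⟩
        + n * bottom + sumFinℤ n f          ≡⟨ cong (λ z → + n * bottom + z) (trans (sum-+ (prefix {n} (suc q)) (prefix q)) (cong₂ _+_ ∑q+1 ∑q)) ⟩
        + n * bottom + (+ suc q + + q)      ≡⟨ cong (λ z → + n * bottom + + z) (sym n≡) ⟩
        + n * bottom + + n                  ≡⟨ cong (λ z → + n * bottom + z) (sym (ℤP.*-identityʳ (+ n))) ⟩
        + n * bottom + + n * + 1            ≡⟨ sym (ℤP.*-distribˡ-+ (+ n) bottom (+ 1)) ⟩
        + n * (bottom + + 1) ∎
        where open ≡-Reasoning
      top≡b+2 : top ≡ bottom + + 2
      top≡b+2 = trans (top≡f μ≡f) (cong₂ (λ x y → bottom + (x + y)) (prefix-< {n} (suc q) Fin.zero (ℕ.s≤s ℕ.z≤n)) (prefix-< {n} q Fin.zero 0<q))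
      q≤tops : + q ≤ multiplicity top
      q≤tops = subst₂ _≤_ ∑q (cong multiplicity (sym top≡b+2))
                 (multiplicity-≥ μ≡f (prefix-binary q) λ j ιj≡1 →
                    cong₂ _+_ (prefix-< (suc q) j (ℕP.m<n⇒m<1+n (prefix-one q j ιj≡1))) ιj≡1)
      q≤bottoms : + q ≤ multiplicity bottom
      q≤bottoms = subst₂ _≤_ ∑q̅ (cong multiplicity (ℤP.+-identityʳ bottom))
                    (multiplicity-≥ μ≡f (complement-binary (prefix-binary (suc q))) λ j ιj≡1 →
                       let q+1≤j = prefix-zero (suc q) j (complement-one (prefix-binary (suc q)) {j} ιj≡1) in
                       cong₂ _+_ (prefix-≥ (suc q) j q+1≤j) (prefix-≥ q j (ℕP.<⇒≤ q+1≤j)))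
        where
        ∑q̅ : sumFinℤ n (complement (prefix (suc q))) ≡ + q
        ∑q̅ = trans (sum-complement (prefix {n} (suc q))) (trans (cong₂ (λ a b → + a - b) n≡ ∑q+1) (cancel (+ q)))
          where
          cancel : ∀ x → + 1 + (x + x) - (+ 1 + x) ≡ x
          cancel = solve-∀

    -- λ = (c + 2, c + 1, …, c + 1, c): only one coordinate of a vertex exceeds c + 1, by exactly 1
    fam2-reflexive : μ ≗ fam2 n → Reflexive S
    fam2-reflexive μ≗ = reflexive-if-bounded lam gap (bottom + + 1) N≡n[b+1] bound
      where
      f : Point n
      f i = prefix 1 i + prefix (suc k) i
      μ≡f : ∀ i → + μ i ≡ f i
      μ≡f i = trans (cong +_ (μ≗ i)) (fam2-prefix k i)
      N≡n[b+1] : N ≡ + n * (bottom + + 1)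
      N≡n[b+1] = begin
        N                                   ≡⟨ N≡f μ≡f ⟩
        + n * bottom + sumFinℤ n f          ≡⟨ cong (λ z → + n * bottom + z) (trans (sum-+ (prefix {n} 1) (prefix (suc k)))
                                                                                   (cong₂ _+_ (sum-prefix n 1 (ℕ.s≤s ℕ.z≤n)) (sum-prefix n (suc k) (ℕP.n≤1+n (suc k))))) ⟩
        + n * bottom + + n                  ≡⟨ cong (λ z → + n * bottom + z) (sym (ℤP.*-identityʳ (+ n))) ⟩
        + n * bottom + + n * + 1            ≡⟨ sym (ℤP.*-distribˡ-+ (+ n) bottom (+ 1)) ⟩
        + n * (bottom + + 1) ∎
        where open ≡-Reasoning
      top≡b+2 : top ≡ bottom + + 2
      top≡b+2 = top≡f μ≡f
      top-1≡b+1 : top - + 1 ≡ bottom + + 1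
      top-1≡b+1 = trans (cong (_- + 1) top≡b+2) (drop bottom)
        where
        drop : ∀ b → b + + 2 - + 1 ≡ b + + 1
        drop = solve-∀
      at-top : ∀ j → indicator (+ lam j ℤ.≟ top) ≡ prefix 1 j
      at-top Fin.zero    = indicator-yes (+ lam Fin.zero ℤ.≟ top) refl
      at-top (Fin.suc j) = indicator-no (+ lam (Fin.suc j) ℤ.≟ top) λ λj≡top →
        ℤP.<-irrefl (trans (sym (lam≡f μ≡f (Fin.suc j))) (trans λj≡top top≡b+2))
                    (ℤP.+-monoʳ-< bottom (subst (_< + 2) (sym (ℤP.+-identityˡ (prefix (suc k) (Fin.suc j))))
                                                    (ℤP.≤-<-trans (binary-≤1 (prefix-binary (suc k)) (Fin.suc j)) (ℤ.+<+ ℕP.≤-refl))))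
      single-top : multiplicity top ≡ + 1
      single-top = trans (sum-cong at-top) (sum-prefix n 1 (ℕ.s≤s ℕ.z≤n))
      bound : ∀ {χ v} → Binary χ → Facet S χ → MaxAt S χ v → dot χ v ≤ (bottom + + 1) * sumFinℤ n χ + + 1
      bound {χ} {v} χ-bin _ v-max =
        subst₂ (λ d m → dot χ v ≤ d * sumFinℤ n χ + m) top-1≡b+1 single-top (dot-≤-below-top χ-bin (proj₁ v-max))

    sufficiency : InList n μ → Reflexive S
    sufficiency (inj₁ μ≗)                               = fam1-reflexive μ≗
    sufficiency (inj₂ (inj₁ μ≗))                        = fam2-reflexive μ≗
    sufficiency (inj₂ (inj₂ (inj₁ (n-even , μ≗))))      = fam3-reflexive n-even μ≗
    sufficiency (inj₂ (inj₂ (inj₂ (inj₁ (n-odd , μ≗))))) = fam4-reflexive n-odd μ≗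
    sufficiency (inj₂ (inj₂ (inj₂ (inj₂ μ≗))))          = fam5-reflexive μ≗

open import Data.Nat using (ℕ; suc; _<_)
open import Data.Fin using (Fin; zero; fromℕ)
open import Function.Bundles using (_⇔_; mk⇔)
open Permutohedra using (module Necessity; module Sufficiency)

theorem4p6 : (k : ℕ) → (lam : Fin (suc (suc k)) → ℕ) → IsPartition lam →
    lam (fromℕ (suc k)) < lam zero →
    (Reflexive (Orbit lam) ⇔ InList (suc (suc k)) (reduce lam))
theorem4p6 k lam partition gap =
  mk⇔ (Necessity.necessity lam partition gap) (Sufficiency.sufficiency lam partition gap)
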